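{- There exists a natural transformation $\eta:\mathrm{id}_{\mathrm{Syn}(\mathsf{MCaTT})}\Rightarrow\mathrm{D}\circ\Sigma_r$ which is a natural isomorphism.
   Context: $\mathsf{CaTT}$ is the Finster–Mimram type theory for weak $\omega$-categories (types $\star$, $\mathrm{Hom}_Atu$; terms variables, $\mathsf{op}$, $\mathsf{coh}$ indexed by ps-contexts). $\mathsf{MCaTT}$ is the type theory with a unit type $\mathbb{1}$ (constant $()$, $\eta$-rule making every term of type $\mathbb{1}$ definitionally equal to $()$), types $\mathrm{Hom}_Atu$ ($\star$ abbreviating $\mathrm{Hom}_{\mathbb{1}}()()$) and term constructors $\mathsf{mop}$, $\mathsf{mcoh}$. $\mathrm{Syn}(T)$ is the syntactic category. The desuspension functor $\mathrm{D}:\mathrm{Syn}(\mathsf{CaTT})\to\mathrm{Syn}(\mathsf{MCaTT})$ replaces $\star$ by $\mathbb{1}$, $\mathsf{op}$ by $\mathsf{mop}$, $\mathsf{coh}$ by $\mathsf{mcoh}$, and is the identity on variables. The reduced suspension functor $\Sigma_r:\mathrm{Syn}(\mathsf{MCaTT})\to\mathrm{Syn}(\mathsf{CaTT})$ adds a fresh variable $\bullet:\star$ ($\Sigma_r\emptyset=(\bullet:\star)$), sends $\mathbb{1}$ to $\star$, $()$ to $\bullet$, $\star$ to $\mathrm{Hom}_\star\bullet\bullet$, drops context variables of type $\mathbb{1}$, keeps other variables, and sends $\mathsf{mop}_{\Theta,A}[\gamma]$ to $\mathsf{op}_{\Theta,A}[\bullet_\Theta\circ\Sigma_r\gamma]$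 (similarly for $\mathsf{mcoh}$), where $\bullet_\Theta$ sends variables of type $\star$ to $\bullet$ and others to themselves. -}

module Defs where

open import Data.Nat using (ℕ; zero; suc; _⊔_; _∸_; _≡ᵇ_; _≤ᵇ_)
open import Data.Bool using (Bool; true; false; if_then_else_)
open import Data.List using (List; []; _∷_; _++_)
open import Data.List.Membership.Propositional using (_∈_; _∉_)
open import Data.Product using (_×_)
open import Relation.Binary.PropositionalEquality using (_≡_; _≢_)

-- Variable names are natural numbers (named-variable presentation).
Name : Set
Name = ℕ

_≋_ : List Name → List Name → Set
xs ≋ ys = ∀ x → (x ∈ xs → x ∈ ys) × (x ∈ ys → x ∈ xs)

infix 4 _≋_

module C where

  infixl 5 _▸_∶_ _▸_↦_

  data Ty  : Set
  data Tm  : Set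
  data Ctx : Set
  data Sub : Set

  data Ty where
    ⋆   : Ty
    Hom : Ty → Tm → Tm → Ty

  data Tm where
    var : Name → Tm
    op  : Ctx → Ty → Sub → Tm
    coh : Ctx → Ty → Sub → Tm

  data Ctx where
    ∅     : Ctx
    _▸_∶_ : Ctx → Name → Ty → Ctx

  data Sub where
    ⟨⟩    : Sub
    _▸_↦_ : Sub → Name → Tm → Sub

  names : Ctx → List Name
  names ∅ = []
  names (Γ ▸ x ∶ A) = x ∷ names Γ

  lookup : Sub → Name → Tm
  lookup ⟨⟩ x = var x
  lookup (γ ▸ y ↦ t) x = if x ≡ᵇ y then t else lookup γ x

  infixl 8 _[_]ty _[_]tm
  infixl 7 _∘_

  _[_]ty : Ty → Sub → Ty
  _[_]tm : Tm → Sub → Tm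
  _∘_    : Sub → Sub → Sub

  ⋆ [ δ ]ty = ⋆
  Hom A t u [ δ ]ty = Hom (A [ δ ]ty) (t [ δ ]tm) (u [ δ ]tm)
  var x [ δ ]tm = lookup δ x
  op Θ A γ [ δ ]tm = op Θ A (γ ∘ δ)
  coh Θ A γ [ δ ]tm = coh Θ A (γ ∘ δ)
  ⟨⟩ ∘ δ = ⟨⟩
  (γ ▸ x ↦ t) ∘ δ = (γ ∘ δ) ▸ x ↦ (t [ δ ]tm)

  FVty  : Ty → List Name
  FVtm  : Tm → List Name
  FVsub : Sub → List Name
  FVty ⋆ = []
  FVty (Hom A t u) = FVty A ++ (FVtm t ++ FVtm u)
  FVtm (var x) = x ∷ []
  FVtm (op Θ A γ) = FVsub γ
  FVtm (coh Θ A γ) = FVsub γ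
  FVsub ⟨⟩ = []
  FVsub (γ ▸ x ↦ t) = FVtm t ++ FVsub γ

  dimTy : Ty → ℕ
  dimTy ⋆ = 0
  dimTy (Hom A t u) = suc (dimTy A)

  dim : Ctx → ℕ
  dim ∅ = 0
  dim (Γ ▸ x ∶ A) = dim Γ ⊔ dimTy A

  dropLast : Ctx → Ctx
  dropLast ∅ = ∅
  dropLast (Γ ▸ x ∶ A) = Γ

  srcᵢ : ℕ → Ctx → Ctx
  srcᵢ i (Γ ▸ y ∶ A ▸ f ∶ B) =
    if i ≤ᵇ dimTy A then srcᵢ i Γ else (srcᵢ i Γ ▸ y ∶ A ▸ f ∶ B)
  srcᵢ i Γ = Γ

  tgtᵢ : ℕ → Ctx → Ctx
  tgtᵢ i (Γ ▸ y ∶ A ▸ f ∶ B) =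
    if suc i ≤ᵇ dimTy A then tgtᵢ i Γ
    else (if i ≡ᵇ dimTy A then (dropLast (tgtᵢ i Γ) ▸ y ∶ A)
          else (tgtᵢ i Γ ▸ y ∶ A ▸ f ∶ B))
  tgtᵢ i Γ = Γ

  ∂⁻ : Ctx → Ctx
  ∂⁻ Γ = srcᵢ (dim Γ ∸ 1) Γ

  ∂⁺ : Ctx → Ctx
  ∂⁺ Γ = tgtᵢ (dim Γ ∸ 1) Γ

  data _∋_∶_ : Ctx → Name → Ty → Set where
    here  : ∀ {Γ x A} → (Γ ▸ x ∶ A) ∋ x ∶ A
    there : ∀ {Γ x y A B} → Γ ∋ x ∶ A → (Γ ▸ y ∶ B) ∋ x ∶ A

  data _⊢ps_∶_ : Ctx → Name → Ty → Set where
    pss : ∀ x → (∅ ▸ x ∶ ⋆) ⊢ps x ∶ ⋆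
    pse : ∀ {Γ x A y f} → Γ ⊢ps x ∶ A → y ∉ names Γ → f ∉ names Γ → y ≢ f →
          (Γ ▸ y ∶ A ▸ f ∶ Hom A (var x) (var y)) ⊢ps f ∶ Hom A (var x) (var y)
    psd : ∀ {Γ f A x y} → Γ ⊢ps f ∶ Hom A (var x) (var y) → Γ ⊢ps y ∶ A

  data _⊢ps : Ctx → Set where
    ps : ∀ {Γ x} → Γ ⊢ps x ∶ ⋆ → Γ ⊢ps

  infix 3 ⊢_ _⊢ty_ _⊢_∶_ _⊢s_∶_

  data ⊢_    : Ctx → Set
  data _⊢ty_ : Ctx → Ty → Set
  data _⊢_∶_ : Ctx → Tm → Ty → Set
  data _⊢s_∶_ : Ctx → Sub → Ctx → Set

  data ⊢_ where
    ⊢∅   : ⊢ ∅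
    ⊢ext : ∀ {Γ x A} → Γ ⊢ty A → x ∉ names Γ → ⊢ (Γ ▸ x ∶ A)

  data _⊢ty_ where
    ⋆-wf   : ∀ {Γ} → ⊢ Γ → Γ ⊢ty ⋆
    Hom-wf : ∀ {Γ A t u} → Γ ⊢ t ∶ A → Γ ⊢ u ∶ A → Γ ⊢ty Hom A t u

  data _⊢_∶_ where
    var : ∀ {Γ x A} → ⊢ Γ → Γ ∋ x ∶ A → Γ ⊢ var x ∶ A
    coh : ∀ {Θ A Δ γ} → Θ ⊢ps → Θ ⊢ty A → FVty A ≋ names Θ →
          Δ ⊢s γ ∶ Θ → Δ ⊢ coh Θ A γ ∶ A [ γ ]ty
    op  : ∀ {Θ A t u Δ γ} → Θ ⊢ps →
          ∂⁻ Θ ⊢ t ∶ A → ∂⁺ Θ ⊢ u ∶ A →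
          FVtm t ++ FVty A ≋ names (∂⁻ Θ) →
          FVtm u ++ FVty A ≋ names (∂⁺ Θ) →
          Δ ⊢s γ ∶ Θ → Δ ⊢ op Θ (Hom A t u) γ ∶ Hom A t u [ γ ]ty

  data _⊢s_∶_ where
    ⟨⟩-wf : ∀ {Δ} → ⊢ Δ → Δ ⊢s ⟨⟩ ∶ ∅
    ▸-wf  : ∀ {Δ Γ γ x A t} → Δ ⊢s γ ∶ Γ → Γ ⊢ty A → x ∉ names Γ →
            Δ ⊢ t ∶ A [ γ ]ty → Δ ⊢s (γ ▸ x ↦ t) ∶ (Γ ▸ x ∶ A)

module M where

  infixl 5 _▸_∶_ _▸_↦_

  data Ty  : Set
  data Tm  : Set
  data Ctx : Set
  data Sub : Set

  data Ty where
    𝟙   : Ty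
    Hom : Ty → Tm → Tm → Ty

  data Tm where
    var  : Name → Tm
    tt   : Tm
    mop  : C.Ctx → C.Ty → Sub → Tm
    mcoh : C.Ctx → C.Ty → Sub → Tm

  data Ctx where
    ∅     : Ctx
    _▸_∶_ : Ctx → Name → Ty → Ctx

  data Sub where
    ⟨⟩    : Sub
    _▸_↦_ : Sub → Name → Tm → Sub

  ⋆ : Ty
  ⋆ = Hom 𝟙 tt tt

  names : Ctx → List Name
  names ∅ = []
  names (Γ ▸ x ∶ A) = x ∷ names Γ

  lookup : Sub → Name → Tm
  lookup ⟨⟩ x = var x
  lookup (γ ▸ y ↦ t) x = if x ≡ᵇ y then t else lookup γ x

  infixl 8 _[_]ty _[_]tm
  infixl 7 _∘_

  _[_]ty : Ty → Sub → Ty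
  _[_]tm : Tm → Sub → Tm
  _∘_    : Sub → Sub → Sub
  𝟙 [ δ ]ty = 𝟙
  Hom A t u [ δ ]ty = Hom (A [ δ ]ty) (t [ δ ]tm) (u [ δ ]tm)
  var x [ δ ]tm = lookup δ x
  tt [ δ ]tm = tt
  mop Θ A γ [ δ ]tm = mop Θ A (γ ∘ δ)
  mcoh Θ A γ [ δ ]tm = mcoh Θ A (γ ∘ δ)
  ⟨⟩ ∘ δ = ⟨⟩
  (γ ▸ x ↦ t) ∘ δ = (γ ∘ δ) ▸ x ↦ (t [ δ ]tm)

  id : Ctx → Sub
  id ∅ = ⟨⟩
  id (Γ ▸ x ∶ A) = id Γ ▸ x ↦ var x

  data _∋_∶_ : Ctx → Name → Ty → Set where
    here  : ∀ {Γ x A} → (Γ ▸ x ∶ A) ∋ x ∶ A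
    there : ∀ {Γ x y A B} → Γ ∋ x ∶ A → (Γ ▸ y ∶ B) ∋ x ∶ A

Dty  : C.Ty → M.Ty
Dtm  : C.Tm → M.Tm
Dsub : C.Sub → M.Sub
Dty C.⋆ = M.𝟙
Dty (C.Hom A t u) = M.Hom (Dty A) (Dtm t) (Dtm u)
Dtm (C.var x) = M.var x
Dtm (C.op Θ A γ) = M.mop Θ A (Dsub γ)
Dtm (C.coh Θ A γ) = M.mcoh Θ A (Dsub γ)
Dsub C.⟨⟩ = M.⟨⟩
Dsub (γ C.▸ x ↦ t) = Dsub γ M.▸ x ↦ Dtm t

Dctx : C.Ctx → M.Ctx
Dctx C.∅ = M.∅
Dctx (Γ C.▸ x ∶ A) = Dctx Γ M.▸ x ∶ Dty A

module MT where
  open M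

  infix 3 ⊢_ _⊢ty_ _⊢_∶_ _⊢s_∶_ _⊢_≈ty_ _⊢_≈_∶_ _⊢_≈s_∶_

  data ⊢_     : Ctx → Set
  data _⊢ty_  : Ctx → Ty → Set
  data _⊢_∶_  : Ctx → Tm → Ty → Set
  data _⊢s_∶_ : Ctx → Sub → Ctx → Set
  data _⊢_≈ty_  : Ctx → Ty → Ty → Set
  data _⊢_≈_∶_  : Ctx → Tm → Tm → Ty → Set
  data _⊢_≈s_∶_ : Ctx → Sub → Sub → Ctx → Set

  data ⊢_ where
    ⊢∅   : ⊢ ∅
    ⊢ext : ∀ {Γ x A} → Γ ⊢ty A → x ∉ names Γ → ⊢ (Γ ▸ x ∶ A)

  data _⊢ty_ where
    𝟙-wf   : ∀ {Γ} → ⊢ Γ → Γ ⊢ty 𝟙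
    Hom-wf : ∀ {Γ A t u} → Γ ⊢ t ∶ A → Γ ⊢ u ∶ A → Γ ⊢ty Hom A t u

  data _⊢_∶_ where
    var  : ∀ {Γ x A} → ⊢ Γ → Γ ∋ x ∶ A → Γ ⊢ var x ∶ A
    tt   : ∀ {Γ} → ⊢ Γ → Γ ⊢ tt ∶ 𝟙
    mcoh : ∀ {Θ A Δ γ} → Θ C.⊢ps → Θ C.⊢ty A → C.FVty A ≋ C.names Θ →
           Δ ⊢s γ ∶ Dctx Θ → Δ ⊢ mcoh Θ A γ ∶ Dty A [ γ ]ty
    mop  : ∀ {Θ A t u Δ γ} → Θ C.⊢ps →
           C.∂⁻ Θ C.⊢ t ∶ A → C.∂⁺ Θ C.⊢ u ∶ A →
           C.FVtm t ++ C.FVty A ≋ C.names (C.∂⁻ Θ) →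
           C.FVtm u ++ C.FVty A ≋ C.names (C.∂⁺ Θ) →
           Δ ⊢s γ ∶ Dctx Θ →
           Δ ⊢ mop Θ (C.Hom A t u) γ ∶ Dty (C.Hom A t u) [ γ ]ty
    conv : ∀ {Γ t A B} → Γ ⊢ t ∶ A → Γ ⊢ A ≈ty B → Γ ⊢ t ∶ B

  data _⊢s_∶_ where
    ⟨⟩-wf : ∀ {Δ} → ⊢ Δ → Δ ⊢s ⟨⟩ ∶ ∅
    ▸-wf  : ∀ {Δ Γ γ x A t} → Δ ⊢s γ ∶ Γ → Γ ⊢ty A → x ∉ names Γ →
            Δ ⊢ t ∶ A [ γ ]ty → Δ ⊢s (γ ▸ x ↦ t) ∶ (Γ ▸ x ∶ A)

  data _⊢_≈ty_ where
    refl-ty  : ∀ {Γ A} → Γ ⊢ty A → Γ ⊢ A ≈ty A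
    sym-ty   : ∀ {Γ A B} → Γ ⊢ A ≈ty B → Γ ⊢ B ≈ty A
    trans-ty : ∀ {Γ A B E} → Γ ⊢ A ≈ty B → Γ ⊢ B ≈ty E → Γ ⊢ A ≈ty E
    Hom-cong : ∀ {Γ A A' t t' u u'} → Γ ⊢ A ≈ty A' →
               Γ ⊢ t ≈ t' ∶ A → Γ ⊢ u ≈ u' ∶ A →
               Γ ⊢ Hom A t u ≈ty Hom A' t' u'

  data _⊢_≈_∶_ where
    refl-tm  : ∀ {Γ t A} → Γ ⊢ t ∶ A → Γ ⊢ t ≈ t ∶ A
    sym-tm   : ∀ {Γ t u A} → Γ ⊢ t ≈ u ∶ A → Γ ⊢ u ≈ t ∶ A
    trans-tm : ∀ {Γ t u v A} → Γ ⊢ t ≈ u ∶ A → Γ ⊢ u ≈ v ∶ A → Γ ⊢ t ≈ v ∶ A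
    conv-eq  : ∀ {Γ t u A B} → Γ ⊢ t ≈ u ∶ A → Γ ⊢ A ≈ty B → Γ ⊢ t ≈ u ∶ B
    η-𝟙      : ∀ {Γ t} → Γ ⊢ t ∶ 𝟙 → Γ ⊢ t ≈ tt ∶ 𝟙
    mcoh-cong : ∀ {Θ A Δ γ γ'} → Θ C.⊢ps → Θ C.⊢ty A → C.FVty A ≋ C.names Θ →
           Δ ⊢ γ ≈s γ' ∶ Dctx Θ →
           Δ ⊢ mcoh Θ A γ ≈ mcoh Θ A γ' ∶ Dty A [ γ ]ty
    mop-cong : ∀ {Θ A t u Δ γ γ'} → Θ C.⊢ps →
           C.∂⁻ Θ C.⊢ t ∶ A → C.∂⁺ Θ C.⊢ u ∶ A →
           C.FVtm t ++ C.FVty A ≋ C.names (C.∂⁻ Θ) →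
           C.FVtm u ++ C.FVty A ≋ C.names (C.∂⁺ Θ) →
           Δ ⊢ γ ≈s γ' ∶ Dctx Θ →
           Δ ⊢ mop Θ (C.Hom A t u) γ ≈ mop Θ (C.Hom A t u) γ'
             ∶ Dty (C.Hom A t u) [ γ ]ty

  data _⊢_≈s_∶_ where
    ⟨⟩-eq : ∀ {Δ} → ⊢ Δ → Δ ⊢ ⟨⟩ ≈s ⟨⟩ ∶ ∅
    ▸-eq  : ∀ {Δ Γ γ δ x A t u} → Δ ⊢ γ ≈s δ ∶ Γ → Γ ⊢ty A → x ∉ names Γ →
            Δ ⊢ t ≈ u ∶ A [ γ ]ty →
            Δ ⊢ (γ ▸ x ↦ t) ≈s (δ ▸ x ↦ u) ∶ (Γ ▸ x ∶ A)

fresh : M.Ctx → Name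
fresh M.∅ = 0
fresh (Γ M.▸ x ∶ A) = suc x ⊔ fresh Γ

isUnit : M.Ty → Bool
isUnit M.𝟙 = true
isUnit (M.Hom _ _ _) = false

-- type of a variable in a context (junk 𝟙 if absent)
typeOf : M.Ctx → Name → M.Ty
typeOf M.∅ x = M.𝟙
typeOf (Γ M.▸ y ∶ A) x = if x ≡ᵇ y then A else typeOf Γ x

isStar : C.Ty → Bool
isStar C.⋆ = true
isStar (C.Hom _ _ _) = false

-- •_Θ : Σr (D Θ) → Θ, sending variables of type ⋆ to • (named b) and
-- the other variables to themselves
bulletSub : Name → C.Ctx → C.Sub
bulletSub b C.∅ = C.⟨⟩
bulletSub b (Θ C.▸ x ∶ A) =
  bulletSub b Θ C.▸ x ↦ (if isStar A then C.var b else C.var x)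

-- Σr on types/terms/substitutions in an ambient (domain) context Δ of
-- MCaTT; the name of • is  fresh Δ.  Variables of type 𝟙 in Δ are dropped
-- by Σr, so they are sent to •.
Σty   : M.Ctx → M.Ty → C.Ty
Σtm   : M.Ctx → M.Tm → C.Tm
Σsub' : M.Ctx → M.Sub → M.Ctx → C.Sub
-- Σsub Δ γ Γ = Σr γ = ⟨ • ↦ •, … ⟩ : Σr Δ → Σr Γ
Σsub  : M.Ctx → M.Sub → M.Ctx → C.Sub

Σty Δ M.𝟙 = C.⋆
Σty Δ (M.Hom A t u) = C.Hom (Σty Δ A) (Σtm Δ t) (Σtm Δ u)
Σtm Δ (M.var x) = if isUnit (typeOf Δ x) then C.var (fresh Δ) else C.var x
Σtm Δ M.tt = C.var (fresh Δ)
Σtm Δ (M.mop Θ A γ) =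
  C.op Θ A (bulletSub (fresh (Dctx Θ)) Θ C.∘ Σsub Δ γ (Dctx Θ))
Σtm Δ (M.mcoh Θ A γ) =
  C.coh Θ A (bulletSub (fresh (Dctx Θ)) Θ C.∘ Σsub Δ γ (Dctx Θ))
Σsub' Δ M.⟨⟩ Γ = C.⟨⟩
Σsub' Δ (γ M.▸ x ↦ t) Γ =
  if isUnit (typeOf Γ x) then Σsub' Δ γ Γ else (Σsub' Δ γ Γ C.▸ x ↦ Σtm Δ t)

Σsub Δ γ Γ = appendSub (C.⟨⟩ C.▸ fresh Γ ↦ C.var (fresh Δ)) (Σsub' Δ γ Γ)
  where
  appendSub : C.Sub → C.Sub → C.Sub
  appendSub σ C.⟨⟩ = σ
  appendSub σ (τ C.▸ x ↦ t) = appendSub σ τ C.▸ x ↦ t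

-- Σctx' Δ Γ : Σr of the prefix Γ of Δ (types translated in Δ; since
-- names are fresh, translating in the whole Δ agrees with translating in Γ)
Σctx' : M.Ctx → M.Ctx → C.Ctx
Σctx' Δ M.∅ = C.∅ C.▸ fresh Δ ∶ C.⋆
Σctx' Δ (Γ M.▸ x ∶ A) =
  if isUnit A then Σctx' Δ Γ else (Σctx' Δ Γ C.▸ x ∶ Σty Δ A)

Σctx : M.Ctx → C.Ctx
Σctx Γ = Σctx' Γ Γ

Σmor : M.Ctx → M.Ctx → M.Sub → C.Sub
Σmor Δ Γ γ = Σsub Δ γ Γ

DΣ : M.Ctx → M.Ctx
DΣ Γ = Dctx (Σctx Γ)

DΣmor : M.Ctx → M.Ctx → M.Sub → M.Sub
DΣmor Δ Γ γ = Dsub (Σmor Δ Γ γ)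

-- η : id ⇒ D ∘ Σr is a natural isomorphism on Syn(MCaTT), where a morphism
-- Δ → Γ is a substitution Δ ⊢ γ : Γ up to definitional equality, and
-- composition is γ ∘ δ = γ[δ].
IsNatIso : (M.Ctx → M.Sub) → Set
IsNatIso η =
    (∀ Γ → MT.⊢ Γ → Γ MT.⊢s η Γ ∶ DΣ Γ)
  × (∀ Δ Γ γ → MT.⊢ Δ → MT.⊢ Γ → Δ MT.⊢s γ ∶ Γ →
       Δ MT.⊢ η Γ M.∘ γ ≈s DΣmor Δ Γ γ M.∘ η Δ ∶ DΣ Γ)
  × (∀ Γ → MT.⊢ Γ → Σ M.Sub λ θ →
         (DΣ Γ MT.⊢s θ ∶ Γ)
       × (Γ MT.⊢ θ M.∘ η Γ ≈s M.id Γ ∶ Γ)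
       × (DΣ Γ MT.⊢ η Γ M.∘ θ ≈s M.id (DΣ Γ) ∶ DΣ Γ))
  where open import Data.Product using (Σ)

{-# OPTIONS --safe #-}
-- D Σr Γ is Γ with its variables of type 𝟙 deleted and one fresh variable • : 𝟙
-- added.  The component η_Γ : Γ → D Σr Γ sends • to () and every other variable
-- to itself; its inverse θ_Γ sends the variables of type 𝟙 to () and the others
-- to themselves.  Both composites are identities up to the η-rule of 𝟙, because
-- a well-typed term of type 𝟙 is a variable or () (a coherence of type ⋆ would
-- need a ps-context without variables), and D Σr sends every such term to •.
-- The work lies in the metatheory: D ∘ Σr preserves typing and definitional
-- equality, t ≈ (D Σr t)[η] and D Σr t ≈ t[θ], all by induction on derivations.
-- The mcoh/mop cases rest on the fact that in a well-typed CaTT substitution out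
-- of a ps-context the arguments of type ⋆ are variables, which is what lets
-- Σr commute with substitution.
module Submission where

open import Defs
open import Data.Bool using (true; false; if_then_else_)
open import Data.Empty using (⊥; ⊥-elim)
open import Data.List using (List; []; _∷_)
open import Data.List.Membership.Propositional using (_∈_; _∉_)
open import Data.List.Relation.Binary.Subset.Propositional using (_⊆_)
open import Data.List.Relation.Binary.Subset.Propositional.Properties using (⊆-reflexive)
open import Data.List.Relation.Unary.Any using (here; there)
open import Data.Nat using (ℕ; zero; suc; _≡ᵇ_; _<_; _≤_; _≤ᵇ_)
open import Data.Nat.Properties using (m≤m⊔n; m≤n⊔m; <-≤-trans; ≤-trans; <-irrefl; ≤-refl; <⇒≢)
open import Data.Product using (Σ; _×_; _,_; proj₁; proj₂)
open import Data.Sum using (_⊎_; inj₁; inj₂)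
open import Data.Unit using (⊤; tt)
open import Relation.Binary.PropositionalEquality
  using (_≡_; _≢_; refl; sym; trans; cong; subst; ≢-sym; module ≡-Reasoning)

≡ᵇ-refl : ∀ n → (n ≡ᵇ n) ≡ true
≡ᵇ-refl zero = refl
≡ᵇ-refl (suc n) = ≡ᵇ-refl n

≢⇒≡ᵇ-false : ∀ {m n} → m ≢ n → (m ≡ᵇ n) ≡ false
≢⇒≡ᵇ-false {zero} {zero} m≢n = ⊥-elim (m≢n refl)
≢⇒≡ᵇ-false {zero} {suc n} m≢n = refl
≢⇒≡ᵇ-false {suc m} {zero} m≢n = refl
≢⇒≡ᵇ-false {suc m} {suc n} m≢n = ≢⇒≡ᵇ-false (λ e → m≢n (cong suc e))

≡ᵇ-true⇒≡ : ∀ {m n} → (m ≡ᵇ n) ≡ true → m ≡ n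
≡ᵇ-true⇒≡ {zero} {zero} e = refl
≡ᵇ-true⇒≡ {suc m} {suc n} e = cong suc (≡ᵇ-true⇒≡ e)

≡ᵇ-false⇒≢ : ∀ {m n} → (m ≡ᵇ n) ≡ false → m ≢ n
≡ᵇ-false⇒≢ {m} e refl with () ← trans (sym (≡ᵇ-refl m)) e

∈∧∉⇒≢ : ∀ {x y : ℕ} {xs} → x ∈ xs → y ∉ xs → x ≢ y
∈∧∉⇒≢ x∈ y∉ refl = y∉ x∈

∈-tail : ∀ {x y : ℕ} {xs} → x ≢ y → x ∈ y ∷ xs → x ∈ xs
∈-tail x≢y (here e) = ⊥-elim (x≢y e)
∈-tail x≢y (there p) = p

M-Hom-≡ : ∀ {A A' t t' u u'} → A ≡ A' → t ≡ t' → u ≡ u' → M.Hom A t u ≡ M.Hom A' t' u'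
M-Hom-≡ refl refl refl = refl

M-▸-≡ : ∀ {γ γ' x t t'} → γ ≡ γ' → t ≡ t' → (γ M.▸ x ↦ t) ≡ (γ' M.▸ x ↦ t')
M-▸-≡ refl refl = refl

M-lookup-here : ∀ γ x t → M.lookup (γ M.▸ x ↦ t) x ≡ t
M-lookup-here γ x t rewrite ≡ᵇ-refl x = refl

M-lookup-there : ∀ γ {x y} t → x ≢ y → M.lookup (γ M.▸ y ↦ t) x ≡ M.lookup γ x
M-lookup-there γ t x≢y rewrite ≢⇒≡ᵇ-false x≢y = refl

C-lookup-here : ∀ γ x t → C.lookup (γ C.▸ x ↦ t) x ≡ t
C-lookup-here γ x t rewrite ≡ᵇ-refl x = refl

C-lookup-there : ∀ γ {x y} t → x ≢ y → C.lookup (γ C.▸ y ↦ t) x ≡ C.lookup γ x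
C-lookup-there γ t x≢y rewrite ≢⇒≡ᵇ-false x≢y = refl

typeOf-here : ∀ Γ x A → typeOf (Γ M.▸ x ∶ A) x ≡ A
typeOf-here Γ x A rewrite ≡ᵇ-refl x = refl

typeOf-there : ∀ Γ {x y} A → x ≢ y → typeOf (Γ M.▸ y ∶ A) x ≡ typeOf Γ x
typeOf-there Γ A x≢y rewrite ≢⇒≡ᵇ-false x≢y = refl

M-∋⇒∈ : ∀ {Γ x A} → Γ M.∋ x ∶ A → x ∈ M.names Γ
M-∋⇒∈ M.here = here refl
M-∋⇒∈ (M.there p) = there (M-∋⇒∈ p)

C-∋⇒∈ : ∀ {Γ x A} → Γ C.∋ x ∶ A → x ∈ C.names Γ
C-∋⇒∈ C.here = here refl
C-∋⇒∈ (C.there p) = there (C-∋⇒∈ p)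

M-∈⇒∋ : ∀ {Γ x} → x ∈ M.names Γ → Σ M.Ty (λ A → Γ M.∋ x ∶ A)
M-∈⇒∋ {Γ M.▸ y ∶ A} (here refl) = A , M.here
M-∈⇒∋ {Γ M.▸ y ∶ A} (there p) with M-∈⇒∋ p
... | B , q = B , M.there q

names-Dctx : ∀ Θ → M.names (Dctx Θ) ≡ C.names Θ
names-Dctx C.∅ = refl
names-Dctx (Θ C.▸ x ∶ A) = cong (x ∷_) (names-Dctx Θ)

∈⇒<fresh : ∀ {Γ x} → x ∈ M.names Γ → x < fresh Γ
∈⇒<fresh {Γ M.▸ y ∶ A} (here refl) = m≤m⊔n (suc y) (fresh Γ)
∈⇒<fresh {Γ M.▸ y ∶ A} (there p) = <-≤-trans (∈⇒<fresh p) (m≤n⊔m (suc y) (fresh Γ))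

typeOf-≥fresh : ∀ Γ z → fresh Γ ≤ z → typeOf Γ z ≡ M.𝟙
typeOf-≥fresh M.∅ z le = refl
typeOf-≥fresh (Γ M.▸ y ∶ A) z le =
  trans (typeOf-there Γ A (λ e → <-irrefl (sym e) (<-≤-trans (m≤m⊔n (suc y) (fresh Γ)) le)))
        (typeOf-≥fresh Γ z (≤-trans (m≤n⊔m (suc y) (fresh Γ)) le))

typeOf-fresh : ∀ Γ → typeOf Γ (fresh Γ) ≡ M.𝟙
typeOf-fresh Γ = typeOf-≥fresh Γ (fresh Γ) ≤-refl

Distinct : M.Ctx → Set
Distinct M.∅ = ⊤
Distinct (Γ M.▸ x ∶ A) = Distinct Γ × x ∉ M.names Γ

typeOf-∋ : ∀ {Γ x A} → Distinct Γ → Γ M.∋ x ∶ A → typeOf Γ x ≡ A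
typeOf-∋ {Γ M.▸ x ∶ A} d M.here = typeOf-here Γ x A
typeOf-∋ {Γ M.▸ y ∶ B} (d , y∉) (M.there p) = trans (typeOf-there Γ B (∈∧∉⇒≢ (M-∋⇒∈ p) y∉)) (typeOf-∋ d p)

M-dom : M.Sub → List ℕ
M-dom M.⟨⟩ = []
M-dom (γ M.▸ x ↦ t) = x ∷ M-dom γ

C-dom : C.Sub → List ℕ
C-dom C.⟨⟩ = []
C-dom (γ C.▸ x ↦ t) = x ∷ C-dom γ

dom-Dsub : ∀ δ → M-dom (Dsub δ) ≡ C-dom δ
dom-Dsub C.⟨⟩ = refl
dom-Dsub (δ C.▸ x ↦ t) = cong (x ∷_) (dom-Dsub δ)

M-lookup-∘ : ∀ γ σ {z} → z ∈ M-dom γ → M.lookup (γ M.∘ σ) z ≡ M.lookup γ z M.[ σ ]tm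
M-lookup-∘ (γ M.▸ x ↦ t) σ {z} p with z ≡ᵇ x in eq
... | true = refl
... | false = M-lookup-∘ γ σ (∈-tail (≡ᵇ-false⇒≢ eq) p)

open MT

wf-ty : ∀ {Γ A} → Γ ⊢ty A → ⊢ Γ
wf-tm : ∀ {Γ t A} → Γ ⊢ t ∶ A → ⊢ Γ
wf-sub : ∀ {Δ γ Γ} → Δ ⊢s γ ∶ Γ → ⊢ Δ
wf-ty (𝟙-wf w) = w
wf-ty (Hom-wf d _) = wf-tm d
wf-tm (var w _) = w
wf-tm (tt w) = w
wf-tm (mcoh _ _ _ d) = wf-sub d
wf-tm (mop _ _ _ _ _ d) = wf-sub d
wf-tm (conv d _) = wf-tm d
wf-sub (⟨⟩-wf w) = w
wf-sub (▸-wf d _ _ _) = wf-sub d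

codomain-wf : ∀ {Δ γ Γ} → Δ ⊢s γ ∶ Γ → ⊢ Γ
codomain-wf (⟨⟩-wf w) = ⊢∅
codomain-wf (▸-wf d wA x∉ dt) = ⊢ext wA x∉

⊢⇒Distinct : ∀ Γ → ⊢ Γ → Distinct Γ
⊢⇒Distinct M.∅ w = tt
⊢⇒Distinct (Γ M.▸ x ∶ A) (⊢ext d x∉) = ⊢⇒Distinct Γ (wf-ty d) , x∉

names≡dom : ∀ {Δ γ Γ} → Δ ⊢s γ ∶ Γ → M.names Γ ≡ M-dom γ
names≡dom (⟨⟩-wf w) = refl
names≡dom (▸-wf {x = x} d _ _ _) = cong (x ∷_) (names≡dom d)

names≡dom-≈s : ∀ {Δ γ δ Γ} → Δ ⊢ γ ≈s δ ∶ Γ → (M.names Γ ≡ M-dom γ) × (M.names Γ ≡ M-dom δ)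
names≡dom-≈s (⟨⟩-eq w) = refl , refl
names≡dom-≈s (▸-eq {x = x} d _ _ _) =
  cong (x ∷_) (proj₁ (names≡dom-≈s d)) , cong (x ∷_) (proj₂ (names≡dom-≈s d))

retype : ∀ {Γ t A B} → A ≡ B → Γ ⊢ t ∶ A → Γ ⊢ t ∶ B
retype refl d = d

reterm : ∀ {Γ t t' A} → t ≡ t' → Γ ⊢ t ∶ A → Γ ⊢ t' ∶ A
reterm refl d = d

retype≈ : ∀ {Γ t u A B} → A ≡ B → Γ ⊢ t ≈ u ∶ A → Γ ⊢ t ≈ u ∶ B
retype≈ refl d = d

reterm≈ : ∀ {Γ t t' u u' A} → t ≡ t' → u ≡ u' → Γ ⊢ t ≈ u ∶ A → Γ ⊢ t' ≈ u' ∶ A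
reterm≈ refl refl d = d

recast≈ty : ∀ {Γ A A' B B'} → A ≡ A' → B ≡ B' → Γ ⊢ A ≈ty B → Γ ⊢ A' ≈ty B'
recast≈ty refl refl d = d

resub≈ : ∀ {Δ γ γ' δ δ' Γ} → γ ≡ γ' → δ ≡ δ' → Δ ⊢ γ ≈s δ ∶ Γ → Δ ⊢ γ' ≈s δ' ∶ Γ
resub≈ refl refl d = d

_⊑_ : M.Ctx → M.Ctx → Set
Γ ⊑ K = ∀ {x A} → Γ M.∋ x ∶ A → K M.∋ x ∶ A

⊑-refl : ∀ {Γ} → Γ ⊑ Γ
⊑-refl p = p

⊑-there : ∀ {Γ x A} → Γ ⊑ (Γ M.▸ x ∶ A)
⊑-there p = M.there p

⊑-tail : ∀ {Γ x A K} → (Γ M.▸ x ∶ A) ⊑ K → Γ ⊑ K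
⊑-tail s p = s (M.there p)

⊑⇒names⊆ : ∀ {Γ K} → Γ ⊑ K → M.names Γ ⊆ M.names K
⊑⇒names⊆ s p with M-∈⇒∋ p
... | A , q = M-∋⇒∈ (s q)

weaken-ty : ∀ {Γ K A} → Γ ⊢ty A → Γ ⊑ K → ⊢ K → K ⊢ty A
weaken-tm : ∀ {Γ K t A} → Γ ⊢ t ∶ A → Γ ⊑ K → ⊢ K → K ⊢ t ∶ A
weaken-sub : ∀ {Γ K γ Θ} → Γ ⊢s γ ∶ Θ → Γ ⊑ K → ⊢ K → K ⊢s γ ∶ Θ
weaken-≈ty : ∀ {Γ K A B} → Γ ⊢ A ≈ty B → Γ ⊑ K → ⊢ K → K ⊢ A ≈ty B
weaken-≈ : ∀ {Γ K t u A} → Γ ⊢ t ≈ u ∶ A → Γ ⊑ K → ⊢ K → K ⊢ t ≈ u ∶ A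
weaken-≈s : ∀ {Γ K γ δ Θ} → Γ ⊢ γ ≈s δ ∶ Θ → Γ ⊑ K → ⊢ K → K ⊢ γ ≈s δ ∶ Θ
weaken-ty (𝟙-wf w) s k = 𝟙-wf k
weaken-ty (Hom-wf d e) s k = Hom-wf (weaken-tm d s k) (weaken-tm e s k)
weaken-tm (var w p) s k = var k (s p)
weaken-tm (tt w) s k = tt k
weaken-tm (mcoh a b c d) s k = mcoh a b c (weaken-sub d s k)
weaken-tm (mop a b c d e f) s k = mop a b c d e (weaken-sub f s k)
weaken-tm (conv d e) s k = conv (weaken-tm d s k) (weaken-≈ty e s k)
weaken-sub (⟨⟩-wf w) s k = ⟨⟩-wf k
weaken-sub (▸-wf d a n e) s k = ▸-wf (weaken-sub d s k) a n (weaken-tm e s k)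
weaken-≈ty (refl-ty d) s k = refl-ty (weaken-ty d s k)
weaken-≈ty (sym-ty d) s k = sym-ty (weaken-≈ty d s k)
weaken-≈ty (trans-ty d e) s k = trans-ty (weaken-≈ty d s k) (weaken-≈ty e s k)
weaken-≈ty (Hom-cong d e f) s k = Hom-cong (weaken-≈ty d s k) (weaken-≈ e s k) (weaken-≈ f s k)
weaken-≈ (refl-tm d) s k = refl-tm (weaken-tm d s k)
weaken-≈ (sym-tm d) s k = sym-tm (weaken-≈ d s k)
weaken-≈ (trans-tm d e) s k = trans-tm (weaken-≈ d s k) (weaken-≈ e s k)
weaken-≈ (conv-eq d e) s k = conv-eq (weaken-≈ d s k) (weaken-≈ty e s k)
weaken-≈ (η-𝟙 d) s k = η-𝟙 (weaken-tm d s k)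
weaken-≈ (mcoh-cong a b c d) s k = mcoh-cong a b c (weaken-≈s d s k)
weaken-≈ (mop-cong a b c d e f) s k = mop-cong a b c d e (weaken-≈s f s k)
weaken-≈s (⟨⟩-eq w) s k = ⟨⟩-eq k
weaken-≈s (▸-eq d a n e) s k = ▸-eq (weaken-≈s d s k) a n (weaken-≈ e s k)

ScopedTy : List ℕ → M.Ty → Set
ScopedTm : List ℕ → M.Tm → Set
ScopedSub : List ℕ → M.Sub → Set
ScopedTy L M.𝟙 = ⊤
ScopedTy L (M.Hom A t u) = ScopedTy L A × ScopedTm L t × ScopedTm L u
ScopedTm L (M.var x) = x ∈ L
ScopedTm L M.tt = ⊤
ScopedTm L (M.mop Θ A γ) = ScopedSub L γ
ScopedTm L (M.mcoh Θ A γ) = ScopedSub L γ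
ScopedSub L M.⟨⟩ = ⊤
ScopedSub L (γ M.▸ x ↦ t) = ScopedSub L γ × ScopedTm L t

scoped-mono-ty : ∀ {L K} A → L ⊆ K → ScopedTy L A → ScopedTy K A
scoped-mono-tm : ∀ {L K} t → L ⊆ K → ScopedTm L t → ScopedTm K t
scoped-mono-sub : ∀ {L K} γ → L ⊆ K → ScopedSub L γ → ScopedSub K γ
scoped-mono-ty M.𝟙 s h = h
scoped-mono-ty (M.Hom A t u) s (a , b , c) = scoped-mono-ty A s a , scoped-mono-tm t s b , scoped-mono-tm u s c
scoped-mono-tm (M.var x) s h = s h
scoped-mono-tm M.tt s h = h
scoped-mono-tm (M.mop Θ A γ) s h = scoped-mono-sub γ s h
scoped-mono-tm (M.mcoh Θ A γ) s h = scoped-mono-sub γ s h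
scoped-mono-sub M.⟨⟩ s h = h
scoped-mono-sub (γ M.▸ x ↦ t) s (a , b) = scoped-mono-sub γ s a , scoped-mono-tm t s b

[]-▸-fresh-ty : ∀ {L} A σ {x} t → ScopedTy L A → x ∉ L → A M.[ σ M.▸ x ↦ t ]ty ≡ A M.[ σ ]ty
[]-▸-fresh-tm : ∀ {L} u σ {x} t → ScopedTm L u → x ∉ L → u M.[ σ M.▸ x ↦ t ]tm ≡ u M.[ σ ]tm
∘-▸-fresh : ∀ {L} γ σ {x} t → ScopedSub L γ → x ∉ L → γ M.∘ (σ M.▸ x ↦ t) ≡ γ M.∘ σ
[]-▸-fresh-ty M.𝟙 σ t h x∉ = refl
[]-▸-fresh-ty (M.Hom A u v) σ t (a , b , c) x∉ =
  M-Hom-≡ ([]-▸-fresh-ty A σ t a x∉) ([]-▸-fresh-tm u σ t b x∉) ([]-▸-fresh-tm v σ t c x∉)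
[]-▸-fresh-tm (M.var z) σ t h x∉ = M-lookup-there σ t (∈∧∉⇒≢ h x∉)
[]-▸-fresh-tm M.tt σ t h x∉ = refl
[]-▸-fresh-tm (M.mop Θ A γ) σ t h x∉ = cong (M.mop Θ A) (∘-▸-fresh γ σ t h x∉)
[]-▸-fresh-tm (M.mcoh Θ A γ) σ t h x∉ = cong (M.mcoh Θ A) (∘-▸-fresh γ σ t h x∉)
∘-▸-fresh M.⟨⟩ σ t h x∉ = refl
∘-▸-fresh (γ M.▸ y ↦ u) σ t (a , b) x∉ = M-▸-≡ (∘-▸-fresh γ σ t a x∉) ([]-▸-fresh-tm u σ t b x∉)

[]-∘-ty : ∀ {L} A σ τ → ScopedTy L A → L ⊆ M-dom σ → (A M.[ σ ]ty) M.[ τ ]ty ≡ A M.[ σ M.∘ τ ]ty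
[]-∘-tm : ∀ {L} u σ τ → ScopedTm L u → L ⊆ M-dom σ → (u M.[ σ ]tm) M.[ τ ]tm ≡ u M.[ σ M.∘ τ ]tm
∘-assoc : ∀ {L} γ σ τ → ScopedSub L γ → L ⊆ M-dom σ → (γ M.∘ σ) M.∘ τ ≡ γ M.∘ (σ M.∘ τ)
[]-∘-ty M.𝟙 σ τ h s = refl
[]-∘-ty (M.Hom A u v) σ τ (a , b , c) s = M-Hom-≡ ([]-∘-ty A σ τ a s) ([]-∘-tm u σ τ b s) ([]-∘-tm v σ τ c s)
[]-∘-tm (M.var z) σ τ h s = sym (M-lookup-∘ σ τ (s h))
[]-∘-tm M.tt σ τ h s = refl
[]-∘-tm (M.mop Θ A γ) σ τ h s = cong (M.mop Θ A) (∘-assoc γ σ τ h s)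
[]-∘-tm (M.mcoh Θ A γ) σ τ h s = cong (M.mcoh Θ A) (∘-assoc γ σ τ h s)
∘-assoc M.⟨⟩ σ τ h s = refl
∘-assoc (γ M.▸ y ↦ u) σ τ (a , b) s = M-▸-≡ (∘-assoc γ σ τ a s) ([]-∘-tm u σ τ b s)

AgreeOn : List ℕ → M.Sub → M.Sub → Set
AgreeOn L σ σ' = ∀ {z} → z ∈ L → M.lookup σ z ≡ M.lookup σ' z

[]-agree-ty : ∀ {L} T σ σ' → ScopedTy L T → AgreeOn L σ σ' → T M.[ σ ]ty ≡ T M.[ σ' ]ty
[]-agree-tm : ∀ {L} u σ σ' → ScopedTm L u → AgreeOn L σ σ' → u M.[ σ ]tm ≡ u M.[ σ' ]tm
∘-agree : ∀ {L} γ σ σ' → ScopedSub L γ → AgreeOn L σ σ' → γ M.∘ σ ≡ γ M.∘ σ'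
[]-agree-ty M.𝟙 σ σ' h a = refl
[]-agree-ty (M.Hom A t u) σ σ' (p , q , r) a =
  M-Hom-≡ ([]-agree-ty A σ σ' p a) ([]-agree-tm t σ σ' q a) ([]-agree-tm u σ σ' r a)
[]-agree-tm (M.var x) σ σ' h a = a h
[]-agree-tm M.tt σ σ' h a = refl
[]-agree-tm (M.mop Θ A γ) σ σ' h a = cong (M.mop Θ A) (∘-agree γ σ σ' h a)
[]-agree-tm (M.mcoh Θ A γ) σ σ' h a = cong (M.mcoh Θ A) (∘-agree γ σ σ' h a)
∘-agree M.⟨⟩ σ σ' h a = refl
∘-agree (γ M.▸ x ↦ t) σ σ' (p , q) a = M-▸-≡ (∘-agree γ σ σ' p a) ([]-agree-tm t σ σ' q a)

scoped-lookup : ∀ {L} γ {z} → ScopedSub L γ → z ∈ M-dom γ → ScopedTm L (M.lookup γ z)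
scoped-lookup (γ M.▸ x ↦ t) {z} (a , b) p with z ≡ᵇ x in eq
... | true = b
... | false = scoped-lookup γ a (∈-tail (≡ᵇ-false⇒≢ eq) p)

scoped-[]-ty : ∀ {L K} A γ → ScopedTy K A → K ⊆ M-dom γ → ScopedSub L γ → ScopedTy L (A M.[ γ ]ty)
scoped-[]-tm : ∀ {L K} u γ → ScopedTm K u → K ⊆ M-dom γ → ScopedSub L γ → ScopedTm L (u M.[ γ ]tm)
scoped-∘ : ∀ {L K} δ γ → ScopedSub K δ → K ⊆ M-dom γ → ScopedSub L γ → ScopedSub L (δ M.∘ γ)
scoped-[]-ty M.𝟙 γ h s g = h
scoped-[]-ty (M.Hom A t u) γ (a , b , c) s g = scoped-[]-ty A γ a s g , scoped-[]-tm t γ b s g , scoped-[]-tm u γ c s g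
scoped-[]-tm (M.var z) γ h s g = scoped-lookup γ g (s h)
scoped-[]-tm M.tt γ h s g = h
scoped-[]-tm (M.mop Θ A δ) γ h s g = scoped-∘ δ γ h s g
scoped-[]-tm (M.mcoh Θ A δ) γ h s g = scoped-∘ δ γ h s g
scoped-∘ M.⟨⟩ γ h s g = h
scoped-∘ (δ M.▸ x ↦ t) γ (a , b) s g = scoped-∘ δ γ a s g , scoped-[]-tm t γ b s g

_⊑C_ : C.Ctx → C.Ctx → Set
Ξ ⊑C Θ = ∀ {z B} → Ξ C.∋ z ∶ B → Θ C.∋ z ∶ B

⊑C-refl : ∀ {Θ} → Θ ⊑C Θ
⊑C-refl p = p

⊑C-trans : ∀ {Θ Ξ Φ} → Θ ⊑C Ξ → Ξ ⊑C Φ → Θ ⊑C Φ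
⊑C-trans s t p = t (s p)

⊑C-there : ∀ {Θ y B} → Θ ⊑C (Θ C.▸ y ∶ B)
⊑C-there p = C.there p

⊑C-ext : ∀ {Ξ Θ y B} → Ξ ⊑C Θ → (Ξ C.▸ y ∶ B) ⊑C (Θ C.▸ y ∶ B)
⊑C-ext s C.here = C.here
⊑C-ext s (C.there p) = C.there (s p)

if-⊑C : ∀ b {X Y Z} → X ⊑C Z → Y ⊑C Z → (if b then X else Y) ⊑C Z
if-⊑C true s t = s
if-⊑C false s t = t

dropLast-⊑C : ∀ Γ → C.dropLast Γ ⊑C Γ
dropLast-⊑C C.∅ p = p
dropLast-⊑C (Γ C.▸ x ∶ A) p = C.there p

srcᵢ-⊑C : ∀ i Γ → C.srcᵢ i Γ ⊑C Γ
srcᵢ-⊑C i C.∅ = ⊑C-refl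
srcᵢ-⊑C i (C.∅ C.▸ x ∶ A) = ⊑C-refl
srcᵢ-⊑C i (Γ C.▸ y ∶ A C.▸ f ∶ B) =
  if-⊑C (i ≤ᵇ C.dimTy A) (⊑C-trans (srcᵢ-⊑C i Γ) (⊑C-trans ⊑C-there ⊑C-there))
        (⊑C-ext (⊑C-ext (srcᵢ-⊑C i Γ)))

tgtᵢ-⊑C : ∀ i Γ → C.tgtᵢ i Γ ⊑C Γ
tgtᵢ-⊑C i C.∅ = ⊑C-refl
tgtᵢ-⊑C i (C.∅ C.▸ x ∶ A) = ⊑C-refl
tgtᵢ-⊑C i (Γ C.▸ y ∶ A C.▸ f ∶ B) =
  if-⊑C (suc i ≤ᵇ C.dimTy A) (⊑C-trans (tgtᵢ-⊑C i Γ) (⊑C-trans ⊑C-there ⊑C-there))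
    (if-⊑C (i ≡ᵇ C.dimTy A)
       (⊑C-trans (⊑C-ext (⊑C-trans (dropLast-⊑C (C.tgtᵢ i Γ)) (tgtᵢ-⊑C i Γ))) ⊑C-there)
       (⊑C-ext (⊑C-ext (tgtᵢ-⊑C i Γ))))

∂⁻-⊑C : ∀ Θ → C.∂⁻ Θ ⊑C Θ
∂⁻-⊑C Θ = srcᵢ-⊑C _ Θ

∂⁺-⊑C : ∀ Θ → C.∂⁺ Θ ⊑C Θ
∂⁺-⊑C Θ = tgtᵢ-⊑C _ Θ

data VarTy (Θ : C.Ctx) : C.Ty → Set where
  v⋆ : VarTy Θ C.⋆
  vHom : ∀ {A x y} → VarTy Θ A → Θ C.∋ x ∶ A → Θ C.∋ y ∶ A → VarTy Θ (C.Hom A (C.var x) (C.var y))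

VarTy-weaken : ∀ {Θ Φ A} → Θ ⊑C Φ → VarTy Θ A → VarTy Φ A
VarTy-weaken s v⋆ = v⋆
VarTy-weaken s (vHom a p q) = vHom (VarTy-weaken s a) (s p) (s q)

VarCtx : C.Ctx → Set
VarCtx C.∅ = ⊤
VarCtx (Θ C.▸ y ∶ B) = VarCtx Θ × VarTy Θ B

VarCtx-lookup : ∀ {Θ z B} → VarCtx Θ → Θ C.∋ z ∶ B → VarTy Θ B
VarCtx-lookup (c , a) C.here = VarTy-weaken ⊑C-there a
VarCtx-lookup (c , a) (C.there p) = VarTy-weaken ⊑C-there (VarCtx-lookup c p)

⊢ps-VarCtx : ∀ {Γ x A} → Γ C.⊢ps x ∶ A → VarCtx Γ × VarTy Γ A × Γ C.∋ x ∶ A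
⊢ps-VarCtx (C.pss x) = (tt , v⋆) , v⋆ , C.here
⊢ps-VarCtx (C.pse d _ _ _) with ⊢ps-VarCtx d
... | c , a , x∶A =
  ((c , a) , vHom (VarTy-weaken ⊑C-there a) (C.there x∶A) C.here) ,
  vHom (VarTy-weaken (⊑C-trans ⊑C-there ⊑C-there) a) (C.there (C.there x∶A)) (C.there C.here) ,
  C.here
⊢ps-VarCtx (C.psd d) with ⊢ps-VarCtx d
... | c , vHom a _ y∶A , _ = c , a , y∶A

⊢ps⇒VarCtx : ∀ {Θ} → Θ C.⊢ps → VarCtx Θ
⊢ps⇒VarCtx (C.ps d) = proj₁ (⊢ps-VarCtx d)

⊢ps⇒nonempty : ∀ {Θ} → Θ C.⊢ps → Σ ℕ (λ z → z ∈ C.names Θ)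
⊢ps⇒nonempty (C.ps d) = _ , C-∋⇒∈ (proj₂ (proj₂ (⊢ps-VarCtx d)))

no-coh-at-⋆ : ∀ {Θ} → Θ C.⊢ps → C.FVty C.⋆ ≋ C.names Θ → ⊥
no-coh-at-⋆ pz fv with ⊢ps⇒nonempty pz
... | z , z∈ with () ← proj₂ (fv z) z∈

C-⋆-tm-is-var : ∀ {Ξ t T} → Ξ C.⊢ t ∶ T → T ≡ C.⋆ → Σ ℕ (λ w → (t ≡ C.var w) × Ξ C.∋ w ∶ C.⋆)
C-⋆-tm-is-var (C.var w p) refl = _ , refl , p
C-⋆-tm-is-var (C.coh {A = C.⋆} pz wA fv d) e = ⊥-elim (no-coh-at-⋆ pz fv)
C-⋆-tm-is-var (C.coh {A = C.Hom _ _ _} pz wA fv d) ()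
C-⋆-tm-is-var (C.op _ _ _ _ _ _) ()

-- Well-typed CaTT syntax is regular
-- (C-⋆-tm-is-var); this is what makes Σr commute with substitution.
module Regular (Θ : C.Ctx) where
  data RegTy : C.Ty → Set
  data RegTm : C.Tm → Set
  data RegSub : C.Ctx → C.Sub → Set
  data RegTy where
    r⋆ : RegTy C.⋆
    rHom : ∀ {A t u} → RegTy A → RegTm t → RegTm u → RegTy (C.Hom A t u)
  data RegTm where
    rvar : ∀ {z B} → Θ C.∋ z ∶ B → RegTm (C.var z)
    rcoh : ∀ {Θ' A δ} → RegSub Θ' δ → RegTm (C.coh Θ' A δ)
    rop : ∀ {Θ' A δ} → RegSub Θ' δ → RegTm (C.op Θ' A δ)
  data RegSub where
    r⟨⟩ : RegSub C.∅ C.⟨⟩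
    r▸⋆ : ∀ {Θ' δ y w} → RegSub Θ' δ → y ∉ C.names Θ' → Θ C.∋ w ∶ C.⋆ →
          RegSub (Θ' C.▸ y ∶ C.⋆) (δ C.▸ y ↦ C.var w)
    r▸Hom : ∀ {Θ' δ y A u v t} → RegSub Θ' δ → y ∉ C.names Θ' → RegTm t →
            RegSub (Θ' C.▸ y ∶ C.Hom A u v) (δ C.▸ y ↦ t)

open Regular

VarTy⇒RegTy : ∀ {Θ A} → VarTy Θ A → RegTy Θ A
VarTy⇒RegTy v⋆ = r⋆
VarTy⇒RegTy (vHom a p q) = rHom (VarTy⇒RegTy a) (rvar p) (rvar q)

reg-lookup : ∀ {Θ Θ' δ z B} → RegSub Θ Θ' δ → Θ' C.∋ z ∶ B → RegTm Θ (C.lookup δ z)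
reg-lookup (r▸⋆ {δ = δ} {y} {w} g y∉ p) C.here rewrite C-lookup-here δ y (C.var w) = rvar p
reg-lookup (r▸Hom {δ = δ} {y} {t = t} g y∉ h) C.here rewrite C-lookup-here δ y t = h
reg-lookup (r▸⋆ {δ = δ} {w = w} g y∉ p) (C.there q)
  rewrite C-lookup-there δ (C.var w) (∈∧∉⇒≢ (C-∋⇒∈ q) y∉) = reg-lookup g q
reg-lookup (r▸Hom {δ = δ} {t = t} g y∉ h) (C.there q)
  rewrite C-lookup-there δ t (∈∧∉⇒≢ (C-∋⇒∈ q) y∉) = reg-lookup g q

reg-lookup-⋆ : ∀ {Θ Θ' δ z} → RegSub Θ Θ' δ → Θ' C.∋ z ∶ C.⋆ →
               Σ ℕ (λ w → (C.lookup δ z ≡ C.var w) × Θ C.∋ w ∶ C.⋆)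
reg-lookup-⋆ (r▸⋆ {δ = δ} {y} {w} g y∉ p) C.here = w , C-lookup-here δ y (C.var w) , p
reg-lookup-⋆ (r▸⋆ {δ = δ} {w = w} g y∉ p) (C.there q)
  rewrite C-lookup-there δ (C.var w) (∈∧∉⇒≢ (C-∋⇒∈ q) y∉) = reg-lookup-⋆ g q
reg-lookup-⋆ (r▸Hom {δ = δ} {t = t} g y∉ h) (C.there q)
  rewrite C-lookup-there δ t (∈∧∉⇒≢ (C-∋⇒∈ q) y∉) = reg-lookup-⋆ g q

reg-[]-ty : ∀ {Θ Φ δ A} → RegSub Φ Θ δ → RegTy Θ A → RegTy Φ (A C.[ δ ]ty)
reg-[]-tm : ∀ {Θ Φ δ t} → RegSub Φ Θ δ → RegTm Θ t → RegTm Φ (t C.[ δ ]tm)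
reg-∘ : ∀ {Θ Φ δ Θ' δ'} → RegSub Φ Θ δ → RegSub Θ Θ' δ' → RegSub Φ Θ' (δ' C.∘ δ)
reg-[]-ty g r⋆ = r⋆
reg-[]-ty g (rHom a b c) = rHom (reg-[]-ty g a) (reg-[]-tm g b) (reg-[]-tm g c)
reg-[]-tm g (rvar p) = reg-lookup g p
reg-[]-tm g (rcoh h) = rcoh (reg-∘ g h)
reg-[]-tm g (rop h) = rop (reg-∘ g h)
reg-∘ g r⟨⟩ = r⟨⟩
reg-∘ {Φ = Φ} {δ = δ} g (r▸⋆ {Θ' = Θ'} {δ'} {y} h y∉ p) with reg-lookup-⋆ g p
... | w , e , q = subst (λ s → RegSub Φ (Θ' C.▸ y ∶ C.⋆) ((δ' C.∘ δ) C.▸ y ↦ s)) (sym e) (r▸⋆ (reg-∘ g h) y∉ q)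
reg-∘ g (r▸Hom h y∉ k) = r▸Hom (reg-∘ g h) y∉ (reg-[]-tm g k)

⊢⇒reg-ty : ∀ {Θ Ξ A} → Ξ C.⊢ty A → VarCtx Θ → Ξ ⊑C Θ → RegTy Θ A
⊢⇒reg-tm : ∀ {Θ Ξ t A} → Ξ C.⊢ t ∶ A → VarCtx Θ → Ξ ⊑C Θ → RegTm Θ t × RegTy Θ A
⊢⇒reg-sub : ∀ {Θ Ξ δ Θ'} → Ξ C.⊢s δ ∶ Θ' → VarCtx Θ → Ξ ⊑C Θ → RegSub Θ Θ' δ
mcoh-reg : ∀ {Θ A} → Θ C.⊢ps → Θ C.⊢ty A → RegTy Θ A
mop-reg : ∀ {Θ A t u} → Θ C.⊢ps → C.∂⁻ Θ C.⊢ t ∶ A → C.∂⁺ Θ C.⊢ u ∶ A → RegTy Θ (C.Hom A t u)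
⊢⇒reg-ty (C.⋆-wf w) c s = r⋆
⊢⇒reg-ty (C.Hom-wf d e) c s = rHom (proj₂ (⊢⇒reg-tm d c s)) (proj₁ (⊢⇒reg-tm d c s)) (proj₁ (⊢⇒reg-tm e c s))
⊢⇒reg-tm (C.var w p) c s = rvar (s p) , VarTy⇒RegTy (VarCtx-lookup c (s p))
⊢⇒reg-tm (C.coh pz wA _ d) c s = rcoh (⊢⇒reg-sub d c s) , reg-[]-ty (⊢⇒reg-sub d c s) (mcoh-reg pz wA)
⊢⇒reg-tm (C.op pz dt du _ _ d) c s = rop (⊢⇒reg-sub d c s) , reg-[]-ty (⊢⇒reg-sub d c s) (mop-reg pz dt du)
⊢⇒reg-sub (C.⟨⟩-wf w) c s = r⟨⟩
⊢⇒reg-sub (C.▸-wf {A = C.⋆} d wA y∉ dt) c s with C-⋆-tm-is-var dt refl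
... | w , refl , p = r▸⋆ (⊢⇒reg-sub d c s) y∉ (s p)
⊢⇒reg-sub (C.▸-wf {A = C.Hom _ _ _} d wA y∉ dt) c s = r▸Hom (⊢⇒reg-sub d c s) y∉ (proj₁ (⊢⇒reg-tm dt c s))
mcoh-reg pz wA = ⊢⇒reg-ty wA (⊢ps⇒VarCtx pz) ⊑C-refl
mop-reg {Θ} pz dt du =
  rHom (proj₂ (⊢⇒reg-tm dt (⊢ps⇒VarCtx pz) (∂⁻-⊑C Θ))) (proj₁ (⊢⇒reg-tm dt (⊢ps⇒VarCtx pz) (∂⁻-⊑C Θ)))
       (proj₁ (⊢⇒reg-tm du (⊢ps⇒VarCtx pz) (∂⁺-⊑C Θ)))

reg⇒scoped-ty : ∀ {Θ A} → RegTy Θ A → ScopedTy (C.names Θ) (Dty A)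
reg⇒scoped-tm : ∀ {Θ t} → RegTm Θ t → ScopedTm (C.names Θ) (Dtm t)
reg⇒scoped-sub : ∀ {Θ Θ' δ} → RegSub Θ Θ' δ → ScopedSub (C.names Θ) (Dsub δ)
reg⇒scoped-ty r⋆ = tt
reg⇒scoped-ty (rHom a b c) = reg⇒scoped-ty a , reg⇒scoped-tm b , reg⇒scoped-tm c
reg⇒scoped-tm (rvar p) = C-∋⇒∈ p
reg⇒scoped-tm (rcoh g) = reg⇒scoped-sub g
reg⇒scoped-tm (rop g) = reg⇒scoped-sub g
reg⇒scoped-sub r⟨⟩ = tt
reg⇒scoped-sub (r▸⋆ g y∉ p) = reg⇒scoped-sub g , C-∋⇒∈ p
reg⇒scoped-sub (r▸Hom g y∉ h) = reg⇒scoped-sub g , reg⇒scoped-tm h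

reg⇒scoped-Dctx : ∀ {Θ A} → RegTy Θ A → ScopedTy (M.names (Dctx Θ)) (Dty A)
reg⇒scoped-Dctx {Θ} {A} r = scoped-mono-ty (Dty A) (⊆-reflexive (sym (names-Dctx Θ))) (reg⇒scoped-ty r)

D-lookup : ∀ δ x → Dtm (C.lookup δ x) ≡ M.lookup (Dsub δ) x
D-lookup C.⟨⟩ x = refl
D-lookup (δ C.▸ y ↦ t) x with x ≡ᵇ y
... | true = refl
... | false = D-lookup δ x

D-[]-ty : ∀ A δ → Dty (A C.[ δ ]ty) ≡ Dty A M.[ Dsub δ ]ty
D-[]-tm : ∀ t δ → Dtm (t C.[ δ ]tm) ≡ Dtm t M.[ Dsub δ ]tm
D-∘ : ∀ γ δ → Dsub (γ C.∘ δ) ≡ Dsub γ M.∘ Dsub δ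
D-[]-ty C.⋆ δ = refl
D-[]-ty (C.Hom A t u) δ = M-Hom-≡ (D-[]-ty A δ) (D-[]-tm t δ) (D-[]-tm u δ)
D-[]-tm (C.var x) δ = D-lookup δ x
D-[]-tm (C.op Θ A γ) δ = cong (M.mop Θ A) (D-∘ γ δ)
D-[]-tm (C.coh Θ A γ) δ = cong (M.mcoh Θ A) (D-∘ γ δ)
D-∘ C.⟨⟩ δ = refl
D-∘ (γ C.▸ x ↦ t) δ = M-▸-≡ (D-∘ γ δ) (D-[]-tm t δ)

D-∋ : ∀ {Ξ x A} → Ξ C.∋ x ∶ A → Dctx Ξ M.∋ x ∶ Dty A
D-∋ C.here = M.here
D-∋ (C.there p) = M.there (D-∋ p)

D-∋⁻ : ∀ {Ξ x B} → Dctx Ξ M.∋ x ∶ B → Σ C.Ty (λ A → (Ξ C.∋ x ∶ A) × (B ≡ Dty A))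
D-∋⁻ {Ξ C.▸ y ∶ A} M.here = A , C.here , refl
D-∋⁻ {Ξ C.▸ y ∶ A} (M.there p) with D-∋⁻ p
... | A' , q , e = A' , C.there q , e

D-⊑ : ∀ {Ξ Θ} → Ξ ⊑C Θ → Dctx Ξ ⊑ Dctx Θ
D-⊑ s p with D-∋⁻ p
... | A , q , refl = D-∋ (s q)

D-∉ : ∀ {Θ x} → x ∉ C.names Θ → x ∉ M.names (Dctx Θ)
D-∉ {Θ} x∉ p = x∉ (subst (_ ∈_) (names-Dctx Θ) p)

D-∉⁻ : ∀ {Θ x} → x ∉ M.names (Dctx Θ) → x ∉ C.names Θ
D-∉⁻ {Θ} x∉ p = x∉ (subst (_ ∈_) (sym (names-Dctx Θ)) p)

C-names≡dom : ∀ {Ξ δ Θ} → Ξ C.⊢s δ ∶ Θ → C.names Θ ≡ C-dom δ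
C-names≡dom (C.⟨⟩-wf w) = refl
C-names≡dom (C.▸-wf {x = x} d _ _ _) = cong (x ∷_) (C-names≡dom d)

names⊆dom-Dsub : ∀ {Ξ δ Θ} → Ξ C.⊢s δ ∶ Θ → M.names (Dctx Θ) ⊆ M-dom (Dsub δ)
names⊆dom-Dsub {δ = δ} {Θ} d = ⊆-reflexive (trans (names-Dctx Θ) (trans (C-names≡dom d) (sym (dom-Dsub δ))))

D-[]-∘-ty : ∀ A δ σ {L} → ScopedTy L (Dty A) → L ⊆ M-dom (Dsub δ) →
            Dty (A C.[ δ ]ty) M.[ σ ]ty ≡ Dty A M.[ Dsub δ M.∘ σ ]ty
D-[]-∘-ty A δ σ h s = trans (cong (M._[ σ ]ty) (D-[]-ty A δ)) ([]-∘-ty (Dty A) (Dsub δ) σ h s)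

mcoh-scoped : ∀ {Θ A} → Θ C.⊢ps → Θ C.⊢ty A → ScopedTy (M.names (Dctx Θ)) (Dty A)
mcoh-scoped pz wA = reg⇒scoped-Dctx (mcoh-reg pz wA)

mop-scoped : ∀ {Θ A t u} → Θ C.⊢ps → C.∂⁻ Θ C.⊢ t ∶ A → C.∂⁺ Θ C.⊢ u ∶ A →
             ScopedTy (M.names (Dctx Θ)) (Dty (C.Hom A t u))
mop-scoped pz dt du = reg⇒scoped-Dctx (mop-reg pz dt du)

scoped-∋ : ∀ Γ {x A} → ⊢ Γ → Γ M.∋ x ∶ A → ScopedTy (M.names Γ) A
scoped-ty : ∀ {Γ A} → Γ ⊢ty A → ScopedTy (M.names Γ) A
scoped-tm : ∀ {Γ t A} → Γ ⊢ t ∶ A → ScopedTm (M.names Γ) t × ScopedTy (M.names Γ) A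
scoped-sub : ∀ {Δ γ Θ} → Δ ⊢s γ ∶ Θ → ScopedSub (M.names Δ) γ
scoped-≈ty : ∀ {Γ A B} → Γ ⊢ A ≈ty B → ScopedTy (M.names Γ) A × ScopedTy (M.names Γ) B
scoped-≈ : ∀ {Γ t u A} → Γ ⊢ t ≈ u ∶ A →
           ScopedTm (M.names Γ) t × ScopedTm (M.names Γ) u × ScopedTy (M.names Γ) A
scoped-≈s : ∀ {Δ γ δ Θ} → Δ ⊢ γ ≈s δ ∶ Θ → ScopedSub (M.names Δ) γ × ScopedSub (M.names Δ) δ
scoped-∋ (Γ M.▸ x ∶ A) (⊢ext d _) M.here = scoped-mono-ty A there (scoped-ty d)
scoped-∋ (Γ M.▸ y ∶ B) {A = A} (⊢ext d _) (M.there p) = scoped-mono-ty A there (scoped-∋ Γ (wf-ty d) p)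
scoped-ty (𝟙-wf w) = tt
scoped-ty (Hom-wf d e) = proj₂ (scoped-tm d) , proj₁ (scoped-tm d) , proj₁ (scoped-tm e)
scoped-tm {Γ} (var w p) = M-∋⇒∈ p , scoped-∋ Γ w p
scoped-tm (tt w) = tt , tt
scoped-tm (mcoh {A = A} {γ = γ} pz wA fv d) =
  scoped-sub d , scoped-[]-ty (Dty A) γ (mcoh-scoped pz wA) (⊆-reflexive (names≡dom d)) (scoped-sub d)
scoped-tm (mop {A = A} {t} {u} {γ = γ} pz dt du _ _ d) =
  scoped-sub d , scoped-[]-ty (Dty (C.Hom A t u)) γ (mop-scoped pz dt du) (⊆-reflexive (names≡dom d)) (scoped-sub d)
scoped-tm (conv d e) = proj₁ (scoped-tm d) , proj₂ (scoped-≈ty e)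
scoped-sub (⟨⟩-wf w) = tt
scoped-sub (▸-wf d _ _ e) = scoped-sub d , proj₁ (scoped-tm e)
scoped-≈ty (refl-ty d) = scoped-ty d , scoped-ty d
scoped-≈ty (sym-ty d) = proj₂ (scoped-≈ty d) , proj₁ (scoped-≈ty d)
scoped-≈ty (trans-ty d e) = proj₁ (scoped-≈ty d) , proj₂ (scoped-≈ty e)
scoped-≈ty (Hom-cong d e f) =
  (proj₁ (scoped-≈ty d) , proj₁ (scoped-≈ e) , proj₁ (scoped-≈ f)) ,
  (proj₂ (scoped-≈ty d) , proj₁ (proj₂ (scoped-≈ e)) , proj₁ (proj₂ (scoped-≈ f)))
scoped-≈ (refl-tm d) = proj₁ (scoped-tm d) , proj₁ (scoped-tm d) , proj₂ (scoped-tm d)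
scoped-≈ (sym-tm d) = proj₁ (proj₂ (scoped-≈ d)) , proj₁ (scoped-≈ d) , proj₂ (proj₂ (scoped-≈ d))
scoped-≈ (trans-tm d e) = proj₁ (scoped-≈ d) , proj₁ (proj₂ (scoped-≈ e)) , proj₂ (proj₂ (scoped-≈ d))
scoped-≈ (conv-eq d e) = proj₁ (scoped-≈ d) , proj₁ (proj₂ (scoped-≈ d)) , proj₂ (scoped-≈ty e)
scoped-≈ (η-𝟙 d) = proj₁ (scoped-tm d) , tt , tt
scoped-≈ (mcoh-cong {A = A} {γ = γ} pz wA fv d) =
  proj₁ (scoped-≈s d) , proj₂ (scoped-≈s d) ,
  scoped-[]-ty (Dty A) γ (mcoh-scoped pz wA) (⊆-reflexive (proj₁ (names≡dom-≈s d))) (proj₁ (scoped-≈s d))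
scoped-≈ (mop-cong {A = A} {t} {u} {γ = γ} pz dt du _ _ d) =
  proj₁ (scoped-≈s d) , proj₂ (scoped-≈s d) ,
  scoped-[]-ty (Dty (C.Hom A t u)) γ (mop-scoped pz dt du) (⊆-reflexive (proj₁ (names≡dom-≈s d))) (proj₁ (scoped-≈s d))
scoped-≈s (⟨⟩-eq w) = tt , tt
scoped-≈s (▸-eq d _ _ e) =
  (proj₁ (scoped-≈s d) , proj₁ (scoped-≈ e)) , (proj₂ (scoped-≈s d) , proj₁ (proj₂ (scoped-≈ e)))

lookup-⊢ : ∀ {Δ σ Γ x A} → Δ ⊢s σ ∶ Γ → Γ M.∋ x ∶ A → Δ ⊢ M.lookup σ x ∶ A M.[ σ ]ty
lookup-⊢ (▸-wf {γ = σ} {x} {A} {t} d wA x∉ dt) M.here =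
  reterm (sym (M-lookup-here σ x t)) (retype (sym ([]-▸-fresh-ty A σ t (scoped-ty wA) x∉)) dt)
lookup-⊢ (▸-wf {Γ = Γ} {γ = σ} {t = t} d wB y∉ dt) (M.there {A = A} p) =
  reterm (sym (M-lookup-there σ t (∈∧∉⇒≢ (M-∋⇒∈ p) y∉)))
    (retype (sym ([]-▸-fresh-ty A σ t (scoped-∋ Γ (wf-ty wB) p) y∉)) (lookup-⊢ d p))

lookup-≈ : ∀ {Δ σ σ' Γ x A} → Δ ⊢ σ ≈s σ' ∶ Γ → Γ M.∋ x ∶ A →
           Δ ⊢ M.lookup σ x ≈ M.lookup σ' x ∶ A M.[ σ ]ty
lookup-≈ (▸-eq {γ = σ} {σ'} {x} {A} {t} {u} d wA x∉ dt) M.here =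
  reterm≈ (sym (M-lookup-here σ x t)) (sym (M-lookup-here σ' x u))
    (retype≈ (sym ([]-▸-fresh-ty A σ t (scoped-ty wA) x∉)) dt)
lookup-≈ (▸-eq {Γ = Γ} {γ = σ} {σ'} {t = t} {u} d wB y∉ dt) (M.there {A = A} p) =
  reterm≈ (sym (M-lookup-there σ t x≢y)) (sym (M-lookup-there σ' u x≢y))
    (retype≈ (sym ([]-▸-fresh-ty A σ t (scoped-∋ Γ (wf-ty wB) p) y∉)) (lookup-≈ d p))
  where x≢y = ∈∧∉⇒≢ (M-∋⇒∈ p) y∉

[]-⊢ty : ∀ {Γ Δ σ A} → Γ ⊢ty A → Δ ⊢s σ ∶ Γ → Δ ⊢ty A M.[ σ ]ty
[]-⊢tm : ∀ {Γ Δ σ t A} → Γ ⊢ t ∶ A → Δ ⊢s σ ∶ Γ → Δ ⊢ t M.[ σ ]tm ∶ A M.[ σ ]ty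
∘-⊢s : ∀ {Γ Δ σ γ Θ} → Γ ⊢s γ ∶ Θ → Δ ⊢s σ ∶ Γ → Δ ⊢s γ M.∘ σ ∶ Θ
[]-≈ty : ∀ {Γ Δ σ A B} → Γ ⊢ A ≈ty B → Δ ⊢s σ ∶ Γ → Δ ⊢ A M.[ σ ]ty ≈ty B M.[ σ ]ty
[]-≈ : ∀ {Γ Δ σ t u A} → Γ ⊢ t ≈ u ∶ A → Δ ⊢s σ ∶ Γ → Δ ⊢ t M.[ σ ]tm ≈ u M.[ σ ]tm ∶ A M.[ σ ]ty
∘-≈s : ∀ {Γ Δ σ γ δ Θ} → Γ ⊢ γ ≈s δ ∶ Θ → Δ ⊢s σ ∶ Γ → Δ ⊢ γ M.∘ σ ≈s δ M.∘ σ ∶ Θ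
[]-⊢ty (𝟙-wf w) s = 𝟙-wf (wf-sub s)
[]-⊢ty (Hom-wf d e) s = Hom-wf ([]-⊢tm d s) ([]-⊢tm e s)
[]-⊢tm (var w p) s = lookup-⊢ s p
[]-⊢tm (tt w) s = tt (wf-sub s)
[]-⊢tm {σ = σ} (mcoh {A = A} {γ = γ} pz wA fv d) s =
  retype (sym ([]-∘-ty (Dty A) γ σ (mcoh-scoped pz wA) (⊆-reflexive (names≡dom d)))) (mcoh pz wA fv (∘-⊢s d s))
[]-⊢tm {σ = σ} (mop {A = A} {t} {u} {γ = γ} pz dt du f1 f2 d) s =
  retype (sym ([]-∘-ty (Dty (C.Hom A t u)) γ σ (mop-scoped pz dt du) (⊆-reflexive (names≡dom d))))
    (mop pz dt du f1 f2 (∘-⊢s d s))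
[]-⊢tm (conv d e) s = conv ([]-⊢tm d s) ([]-≈ty e s)
∘-⊢s (⟨⟩-wf w) s = ⟨⟩-wf (wf-sub s)
∘-⊢s {σ = σ} (▸-wf {γ = γ} {A = A} d wA x∉ dt) s =
  ▸-wf (∘-⊢s d s) wA x∉ (retype ([]-∘-ty A γ σ (scoped-ty wA) (⊆-reflexive (names≡dom d))) ([]-⊢tm dt s))
[]-≈ty (refl-ty d) s = refl-ty ([]-⊢ty d s)
[]-≈ty (sym-ty d) s = sym-ty ([]-≈ty d s)
[]-≈ty (trans-ty d e) s = trans-ty ([]-≈ty d s) ([]-≈ty e s)
[]-≈ty (Hom-cong d e f) s = Hom-cong ([]-≈ty d s) ([]-≈ e s) ([]-≈ f s)
[]-≈ (refl-tm d) s = refl-tm ([]-⊢tm d s)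
[]-≈ (sym-tm d) s = sym-tm ([]-≈ d s)
[]-≈ (trans-tm d e) s = trans-tm ([]-≈ d s) ([]-≈ e s)
[]-≈ (conv-eq d e) s = conv-eq ([]-≈ d s) ([]-≈ty e s)
[]-≈ (η-𝟙 d) s = η-𝟙 ([]-⊢tm d s)
[]-≈ {σ = σ} (mcoh-cong {A = A} {γ = γ} pz wA fv d) s =
  retype≈ (sym ([]-∘-ty (Dty A) γ σ (mcoh-scoped pz wA) (⊆-reflexive (proj₁ (names≡dom-≈s d)))))
    (mcoh-cong pz wA fv (∘-≈s d s))
[]-≈ {σ = σ} (mop-cong {A = A} {t} {u} {γ = γ} pz dt du f1 f2 d) s =
  retype≈ (sym ([]-∘-ty (Dty (C.Hom A t u)) γ σ (mop-scoped pz dt du) (⊆-reflexive (proj₁ (names≡dom-≈s d)))))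
    (mop-cong pz dt du f1 f2 (∘-≈s d s))
∘-≈s (⟨⟩-eq w) s = ⟨⟩-eq (wf-sub s)
∘-≈s {σ = σ} (▸-eq {γ = γ} {A = A} d wA x∉ dt) s =
  ▸-eq (∘-≈s d s) wA x∉
    (retype≈ ([]-∘-ty A γ σ (scoped-ty wA) (⊆-reflexive (proj₁ (names≡dom-≈s d)))) ([]-≈ dt s))

D-⊢ : ∀ {Ξ} → C.⊢ Ξ → ⊢ Dctx Ξ
D-⊢ty : ∀ {Ξ A} → Ξ C.⊢ty A → Dctx Ξ ⊢ty Dty A
D-⊢tm : ∀ {Ξ t A} → Ξ C.⊢ t ∶ A → Dctx Ξ ⊢ Dtm t ∶ Dty A
D-⊢s : ∀ {Ξ δ Θ} → Ξ C.⊢s δ ∶ Θ → Dctx Ξ ⊢s Dsub δ ∶ Dctx Θ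
D-⊢ C.⊢∅ = ⊢∅
D-⊢ (C.⊢ext d x∉) = ⊢ext (D-⊢ty d) (D-∉ x∉)
D-⊢ty (C.⋆-wf w) = 𝟙-wf (D-⊢ w)
D-⊢ty (C.Hom-wf d e) = Hom-wf (D-⊢tm d) (D-⊢tm e)
D-⊢tm (C.var w p) = var (D-⊢ w) (D-∋ p)
D-⊢tm (C.coh {A = A} {γ = γ} pz wA fv d) = retype (sym (D-[]-ty A γ)) (mcoh pz wA fv (D-⊢s d))
D-⊢tm (C.op {A = A} {t} {u} {γ = γ} pz dt du f1 f2 d) =
  retype (sym (D-[]-ty (C.Hom A t u) γ)) (mop pz dt du f1 f2 (D-⊢s d))
D-⊢s (C.⟨⟩-wf w) = ⟨⟩-wf (D-⊢ w)
D-⊢s (C.▸-wf {γ = γ} {A = A} d wA x∉ dt) = ▸-wf (D-⊢s d) (D-⊢ty wA) (D-∉ x∉) (retype (D-[]-ty A γ) (D-⊢tm dt))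

VarTy-[]-cong : ∀ {Θ A Δ σ σ'} → VarTy Θ A → Δ ⊢s σ ∶ Dctx Θ → Δ ⊢ σ ≈s σ' ∶ Dctx Θ →
                Δ ⊢ Dty A M.[ σ ]ty ≈ty Dty A M.[ σ' ]ty
VarTy-[]-cong v⋆ s e = refl-ty (𝟙-wf (wf-sub s))
VarTy-[]-cong (vHom a p q) s e = Hom-cong (VarTy-[]-cong a s e) (lookup-≈ e (D-∋ p)) (lookup-≈ e (D-∋ q))

D-∘-⊢s : ∀ {Ξ Θ Δ σ δ Θ'} → Ξ C.⊢s δ ∶ Θ' → Ξ ⊑C Θ → Δ ⊢s σ ∶ Dctx Θ →
         Δ ⊢s Dsub δ M.∘ σ ∶ Dctx Θ'
D-∘-⊢s dδ ⊑Θ s = ∘-⊢s (weaken-sub (D-⊢s dδ) (D-⊑ ⊑Θ) (codomain-wf s)) s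

-- MCaTT has no rule making substitution a congruence, so this is proved by
-- induction on the CaTT derivation of which the syntax is the D-image.
D-[]-cong-ty : ∀ {Ξ Θ Δ σ σ' A} → Ξ C.⊢ty A → Ξ ⊑C Θ → VarCtx Θ →
               Δ ⊢s σ ∶ Dctx Θ → Δ ⊢ σ ≈s σ' ∶ Dctx Θ →
               Δ ⊢ Dty A M.[ σ ]ty ≈ty Dty A M.[ σ' ]ty
D-[]-cong-tm : ∀ {Ξ Θ Δ σ σ' t A} → Ξ C.⊢ t ∶ A → Ξ ⊑C Θ → VarCtx Θ →
               Δ ⊢s σ ∶ Dctx Θ → Δ ⊢ σ ≈s σ' ∶ Dctx Θ →
               (Δ ⊢ Dtm t M.[ σ ]tm ≈ Dtm t M.[ σ' ]tm ∶ Dty A M.[ σ ]ty) ×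
               (Δ ⊢ Dty A M.[ σ ]ty ≈ty Dty A M.[ σ' ]ty)
D-∘-cong : ∀ {Ξ Θ Δ σ σ' δ Θ'} → Ξ C.⊢s δ ∶ Θ' → Ξ ⊑C Θ → VarCtx Θ →
           Δ ⊢s σ ∶ Dctx Θ → Δ ⊢ σ ≈s σ' ∶ Dctx Θ →
           Δ ⊢ Dsub δ M.∘ σ ≈s Dsub δ M.∘ σ' ∶ Dctx Θ'
mcoh-ty-cong : ∀ {Θ A Δ σ σ'} → Θ C.⊢ps → Θ C.⊢ty A →
               Δ ⊢s σ ∶ Dctx Θ → Δ ⊢ σ ≈s σ' ∶ Dctx Θ →
               Δ ⊢ Dty A M.[ σ ]ty ≈ty Dty A M.[ σ' ]ty
mop-ty-cong : ∀ {Θ A t u Δ σ σ'} → Θ C.⊢ps → C.∂⁻ Θ C.⊢ t ∶ A → C.∂⁺ Θ C.⊢ u ∶ A →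
              Δ ⊢s σ ∶ Dctx Θ → Δ ⊢ σ ≈s σ' ∶ Dctx Θ →
              Δ ⊢ Dty (C.Hom A t u) M.[ σ ]ty ≈ty Dty (C.Hom A t u) M.[ σ' ]ty
D-[]-cong-ty (C.⋆-wf w) ⊑Θ c s e = refl-ty (𝟙-wf (wf-sub s))
D-[]-cong-ty (C.Hom-wf d f) ⊑Θ c s e =
  Hom-cong (proj₂ (D-[]-cong-tm d ⊑Θ c s e)) (proj₁ (D-[]-cong-tm d ⊑Θ c s e)) (proj₁ (D-[]-cong-tm f ⊑Θ c s e))
D-[]-cong-tm (C.var w p) ⊑Θ c s e = lookup-≈ e (D-∋ (⊑Θ p)) , VarTy-[]-cong (VarCtx-lookup c (⊑Θ p)) s e
D-[]-cong-tm {σ = σ} {σ'} (C.coh {A = B} {γ = δ} pz wB fv dδ) ⊑Θ c s e =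
  retype≈ (sym (push σ)) (mcoh-cong pz wB fv δσ≈δσ') ,
  recast≈ty (sym (push σ)) (sym (push σ')) (mcoh-ty-cong pz wB (D-∘-⊢s dδ ⊑Θ s) δσ≈δσ')
  where
  push = λ τ → D-[]-∘-ty B δ τ (mcoh-scoped pz wB) (names⊆dom-Dsub dδ)
  δσ≈δσ' = D-∘-cong dδ ⊑Θ c s e
D-[]-cong-tm {σ = σ} {σ'} (C.op {A = A} {t} {u} {γ = δ} pz dt du f1 f2 dδ) ⊑Θ c s e =
  retype≈ (sym (push σ)) (mop-cong pz dt du f1 f2 δσ≈δσ') ,
  recast≈ty (sym (push σ)) (sym (push σ')) (mop-ty-cong pz dt du (D-∘-⊢s dδ ⊑Θ s) δσ≈δσ')
  where
  push = λ τ → D-[]-∘-ty (C.Hom A t u) δ τ (mop-scoped pz dt du) (names⊆dom-Dsub dδ)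
  δσ≈δσ' = D-∘-cong dδ ⊑Θ c s e
D-∘-cong (C.⟨⟩-wf w) ⊑Θ c s e = ⟨⟩-eq (wf-sub s)
D-∘-cong {σ = σ} (C.▸-wf {γ = δ} {A = A} d wA x∉ dt) ⊑Θ c s e =
  ▸-eq (D-∘-cong d ⊑Θ c s e) (D-⊢ty wA) (D-∉ x∉)
    (retype≈ (D-[]-∘-ty A δ σ (scoped-ty (D-⊢ty wA)) (names⊆dom-Dsub d)) (proj₁ (D-[]-cong-tm dt ⊑Θ c s e)))
mcoh-ty-cong pz wA s e = D-[]-cong-ty wA ⊑C-refl (⊢ps⇒VarCtx pz) s e
mop-ty-cong {Θ} pz dt du s e =
  Hom-cong (proj₂ (D-[]-cong-tm dt (∂⁻-⊑C Θ) c s e)) (proj₁ (D-[]-cong-tm dt (∂⁻-⊑C Θ) c s e))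
           (proj₁ (D-[]-cong-tm du (∂⁺-⊑C Θ) c s e))
  where c = ⊢ps⇒VarCtx pz

DΣty : M.Ctx → M.Ty → M.Ty
DΣty F A = Dty (Σty F A)

DΣtm : M.Ctx → M.Tm → M.Tm
DΣtm F t = Dtm (Σtm F t)

DΣctx : M.Ctx → M.Ctx → M.Ctx
DΣctx F Γ = Dctx (Σctx' F Γ)

Σtm-var-unit : ∀ F x → isUnit (typeOf F x) ≡ true → Σtm F (M.var x) ≡ C.var (fresh F)
Σtm-var-unit F x e rewrite e = refl

Σtm-var-nonunit : ∀ F x → isUnit (typeOf F x) ≡ false → Σtm F (M.var x) ≡ C.var x
Σtm-var-nonunit F x e rewrite e = refl

Σsub-▸-unit : ∀ F γ Γ x t → isUnit (typeOf Γ x) ≡ true → Σsub F (γ M.▸ x ↦ t) Γ ≡ Σsub F γ Γ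
Σsub-▸-unit F γ Γ x t e rewrite e = refl

Σsub-▸-nonunit : ∀ F γ Γ x t → isUnit (typeOf Γ x) ≡ false →
                 Σsub F (γ M.▸ x ↦ t) Γ ≡ (Σsub F γ Γ C.▸ x ↦ Σtm F t)
Σsub-▸-nonunit F γ Γ x t e rewrite e = refl

Σsub-▸-lookup : ∀ F γ Γ x t {y} → (isUnit (typeOf Γ x) ≡ false → y ≢ x) →
                C.lookup (Σsub F (γ M.▸ x ↦ t) Γ) y ≡ C.lookup (Σsub F γ Γ) y
Σsub-▸-lookup F γ Γ x t {y} y≢x = by-cases (isUnit (typeOf Γ x)) refl
  where
  by-cases : ∀ b → isUnit (typeOf Γ x) ≡ b → C.lookup (Σsub F (γ M.▸ x ↦ t) Γ) y ≡ C.lookup (Σsub F γ Γ) y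
  by-cases true e = cong (λ σ → C.lookup σ y) (Σsub-▸-unit F γ Γ x t e)
  by-cases false e =
    trans (cong (λ σ → C.lookup σ y) (Σsub-▸-nonunit F γ Γ x t e)) (C-lookup-there (Σsub F γ Γ) (Σtm F t) (y≢x e))

Σsub-lookup-• : ∀ F γ Γ → C.lookup (Σsub F γ Γ) (fresh Γ) ≡ C.var (fresh F)
Σsub-lookup-• F M.⟨⟩ Γ = C-lookup-here C.⟨⟩ (fresh Γ) (C.var (fresh F))
Σsub-lookup-• F (γ M.▸ x ↦ t) Γ = trans (Σsub-▸-lookup F γ Γ x t •≢x) (Σsub-lookup-• F γ Γ)
  where
  •≢x : isUnit (typeOf Γ x) ≡ false → fresh Γ ≢ x
  •≢x x≠𝟙 refl with () ← trans (sym (cong isUnit (typeOf-fresh Γ))) x≠𝟙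

Σsub-lookup : ∀ F γ Γ {y} → isUnit (typeOf Γ y) ≡ false → y ∈ M-dom γ →
              C.lookup (Σsub F γ Γ) y ≡ Σtm F (M.lookup γ y)
Σsub-lookup F (γ M.▸ x ↦ t) Γ {y} y≠𝟙 p with y ≡ᵇ x in y≡ᵇx
... | true with refl ← ≡ᵇ-true⇒≡ {y} {x} y≡ᵇx
  rewrite Σsub-▸-nonunit F γ Γ y t y≠𝟙 | ≡ᵇ-refl y = refl
... | false = trans (Σsub-▸-lookup F γ Γ x t (λ _ → y≢x)) (Σsub-lookup F γ Γ y≠𝟙 (∈-tail y≢x p))
  where y≢x = ≡ᵇ-false⇒≢ y≡ᵇx

-- Σtm F t computes Σr t relative to an ambient context F (it consults the
-- types in F and names • as fresh F).  The invariant Within F Γ makes this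
-- agree with Σr on the context Γ, and it is inherited by the prefixes of F
-- met when recursing on contexts.
record Within (F Γ : M.Ctx) : Set where
  constructor within
  field
    typeOf-agrees : ∀ {x A} → Γ M.∋ x ∶ A → typeOf F x ≡ A
    <fresh : ∀ {x} → x ∈ M.names Γ → x < fresh F
open Within

Within-self : ∀ F → ⊢ F → Within F F
Within-self F w = within (typeOf-∋ (⊢⇒Distinct F w)) ∈⇒<fresh

Within-⊑ : ∀ {F Γ K} → Γ ⊑ K → Within F K → Within F Γ
Within-⊑ s c = within (λ p → typeOf-agrees c (s p)) (λ p → <fresh c (⊑⇒names⊆ s p))

Within-tail : ∀ {F Γ x A} → Within F (Γ M.▸ x ∶ A) → Within F Γ
Within-tail = Within-⊑ ⊑-there

Within-▸-≢• : ∀ {F Γ x A} → Within F (Γ M.▸ x ∶ A) → x ≢ fresh F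
Within-▸-≢• c = <⇒≢ (<fresh c (here refl))

isUnit-≈ty : ∀ {Γ A B} → Γ ⊢ A ≈ty B → isUnit A ≡ isUnit B
isUnit-≈ty (refl-ty _) = refl
isUnit-≈ty (sym-ty d) = sym (isUnit-≈ty d)
isUnit-≈ty (trans-ty d e) = trans (isUnit-≈ty d) (isUnit-≈ty e)
isUnit-≈ty (Hom-cong _ _ _) = refl

Σtm-unit : ∀ {F Γ t A} → Γ ⊢ t ∶ A → isUnit A ≡ true → Within F Γ → Σtm F t ≡ C.var (fresh F)
Σtm-unit {F} (var {x = x} w p) e c = Σtm-var-unit F x (trans (cong isUnit (typeOf-agrees c p)) e)
Σtm-unit (tt w) e c = refl
Σtm-unit (mcoh {A = C.⋆} pz wA fv d) e c = ⊥-elim (no-coh-at-⋆ pz fv)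
Σtm-unit (conv d q) e c = Σtm-unit d (trans (isUnit-≈ty q) e) c

Σtm-unit-≈ : ∀ {F Γ t u A} → Γ ⊢ t ≈ u ∶ A → isUnit A ≡ true → Within F Γ →
             (Σtm F t ≡ C.var (fresh F)) × (Σtm F u ≡ C.var (fresh F))
Σtm-unit-≈ (refl-tm d) e c = Σtm-unit d e c , Σtm-unit d e c
Σtm-unit-≈ (sym-tm d) e c = proj₂ (Σtm-unit-≈ d e c) , proj₁ (Σtm-unit-≈ d e c)
Σtm-unit-≈ (trans-tm d f) e c = proj₁ (Σtm-unit-≈ d e c) , proj₂ (Σtm-unit-≈ f e c)
Σtm-unit-≈ (conv-eq d q) e c = Σtm-unit-≈ d (trans (isUnit-≈ty q) e) c
Σtm-unit-≈ (η-𝟙 d) e c = Σtm-unit d e c , refl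
Σtm-unit-≈ (mcoh-cong {A = C.⋆} pz wA fv d) e c = ⊥-elim (no-coh-at-⋆ pz fv)

data Match : C.Ctx → M.Sub → Set where
  m∅ : Match C.∅ M.⟨⟩
  m▸ : ∀ {Θ γ y B t} → Match Θ γ → y ∉ C.names Θ → Match (Θ C.▸ y ∶ B) (γ M.▸ y ↦ t)

⊢s⇒Match : ∀ {Γ γ Θ} → Γ ⊢s γ ∶ Dctx Θ → Match Θ γ
⊢s⇒Match {Θ = C.∅} (⟨⟩-wf w) = m∅
⊢s⇒Match {Θ = Θ C.▸ y ∶ B} (▸-wf d _ y∉ _) = m▸ (⊢s⇒Match d) (D-∉⁻ {Θ} y∉)

≈s⇒Match : ∀ {Γ γ γ' Θ} → Γ ⊢ γ ≈s γ' ∶ Dctx Θ → Match Θ γ × Match Θ γ'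
≈s⇒Match {Θ = C.∅} (⟨⟩-eq w) = m∅ , m∅
≈s⇒Match {Θ = Θ C.▸ y ∶ B} (▸-eq d _ y∉ _) =
  m▸ (proj₁ (≈s⇒Match d)) (D-∉⁻ {Θ} y∉) , m▸ (proj₂ (≈s⇒Match d)) (D-∉⁻ {Θ} y∉)

reg-Match : ∀ {Φ Θ' δ} γ → RegSub Φ Θ' δ → Match Θ' (Dsub δ M.∘ γ)
reg-Match γ r⟨⟩ = m∅
reg-Match γ (r▸⋆ g y∉ p) = m▸ (reg-Match γ g) y∉
reg-Match γ (r▸Hom g y∉ h) = m▸ (reg-Match γ g) y∉

Match-∈ : ∀ {Θ γ y B} → Match Θ γ → Θ C.∋ y ∶ B → y ∈ M-dom γ
Match-∈ (m▸ m y∉) C.here = here refl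
Match-∈ (m▸ m y∉) (C.there p) = there (Match-∈ m p)

Match-Distinct : ∀ {Θ γ} → Match Θ γ → Distinct (Dctx Θ)
Match-Distinct m∅ = tt
Match-Distinct (m▸ {Θ} m y∉) = Match-Distinct m , D-∉ {Θ} y∉

-- Σargs F Θ γ is D(•_Θ ∘ Σr γ), the argument of Σr (mcoh Θ A γ), computed on
-- the MCaTT side: arguments of type ⋆ become •, the others are suspended.
Σarg : M.Ctx → C.Ty → M.Tm → M.Tm
Σarg F C.⋆ t = M.var (fresh F)
Σarg F (C.Hom _ _ _) t = DΣtm F t

Σargs : M.Ctx → C.Ctx → M.Sub → M.Sub
Σargs F C.∅ γ = M.⟨⟩
Σargs F (Θ C.▸ y ∶ B) M.⟨⟩ = M.⟨⟩
Σargs F (Θ C.▸ y ∶ B) (γ M.▸ x ↦ t) = Σargs F Θ γ M.▸ x ↦ Σarg F B t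

Σargs-lookup : ∀ F {Θ γ w B} → Match Θ γ → Θ C.∋ w ∶ B → M.lookup (Σargs F Θ γ) w ≡ Σarg F B (M.lookup γ w)
Σargs-lookup F (m▸ {Θ} {γ} {y} {B} {t} m y∉) C.here =
  trans (M-lookup-here (Σargs F Θ γ) y (Σarg F B t)) (cong (Σarg F B) (sym (M-lookup-here γ y t)))
Σargs-lookup F (m▸ {Θ} {γ} {y} {B'} {t} m y∉) (C.there {A = B} p) =
  trans (M-lookup-there (Σargs F Θ γ) (Σarg F B' t) w≢y)
    (trans (Σargs-lookup F m p) (cong (Σarg F B) (sym (M-lookup-there γ t w≢y))))
  where w≢y = ∈∧∉⇒≢ (C-∋⇒∈ p) y∉

dom-Σargs : ∀ F {Θ γ} → Match Θ γ → M-dom (Σargs F Θ γ) ≡ M-dom γ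
dom-Σargs F m∅ = refl
dom-Σargs F (m▸ {y = y} m y∉) = cong (y ∷_) (dom-Σargs F m)

isUnit-Dty : ∀ B → isUnit (Dty B) ≡ isStar B
isUnit-Dty C.⋆ = refl
isUnit-Dty (C.Hom _ _ _) = refl

SuspendsOn : M.Ctx → C.Sub → C.Ctx → M.Sub → Set
SuspendsOn F S Θ γ = ∀ {y B} → Θ C.∋ y ∶ B → isStar B ≡ false → C.lookup S y ≡ Σtm F (M.lookup γ y)

SuspendsOn-tail : ∀ {F S Θ γ y B t} → SuspendsOn F S (Θ C.▸ y ∶ B) (γ M.▸ y ↦ t) → y ∉ C.names Θ →
                  SuspendsOn F S Θ γ
SuspendsOn-tail {F} {γ = γ} {t = t} S≡Σγ y∉ p ns =
  trans (S≡Σγ (C.there p) ns) (cong (Σtm F) (M-lookup-there γ t (∈∧∉⇒≢ (C-∋⇒∈ p) y∉)))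

D-bullet∘≡Σargs : ∀ F b S {Θ γ} → C.lookup S b ≡ C.var (fresh F) → SuspendsOn F S Θ γ →
                  Match Θ γ → Dsub (bulletSub b Θ C.∘ S) ≡ Σargs F Θ γ
D-bullet∘≡Σargs F b S S•≡• S≡Σγ m∅ = refl
D-bullet∘≡Σargs F b S {Θ C.▸ y ∶ C.⋆} {γ M.▸ .y ↦ t} S•≡• S≡Σγ (m▸ m y∉) =
  M-▸-≡ (D-bullet∘≡Σargs F b S S•≡• (SuspendsOn-tail {F} {S} {γ = γ} S≡Σγ y∉) m) (cong Dtm S•≡•)
D-bullet∘≡Σargs F b S {Θ C.▸ y ∶ C.Hom A u v} {γ M.▸ .y ↦ t} S•≡• S≡Σγ (m▸ m y∉) =
  M-▸-≡ (D-bullet∘≡Σargs F b S S•≡• (SuspendsOn-tail {F} {S} {γ = γ} S≡Σγ y∉) m)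
        (cong Dtm (trans (S≡Σγ C.here refl) (cong (Σtm F) (M-lookup-here γ y t))))

D-bullet∘Σsub≡Σargs : ∀ F {Θ γ} → Match Θ γ →
                      Dsub (bulletSub (fresh (Dctx Θ)) Θ C.∘ Σsub F γ (Dctx Θ)) ≡ Σargs F Θ γ
D-bullet∘Σsub≡Σargs F {Θ} {γ} m =
  D-bullet∘≡Σargs F (fresh (Dctx Θ)) (Σsub F γ (Dctx Θ)) (Σsub-lookup-• F γ (Dctx Θ)) Σsub≡Σγ m
  where
  Σsub≡Σγ : SuspendsOn F (Σsub F γ (Dctx Θ)) Θ γ
  Σsub≡Σγ {y} {B} p ns =
    Σsub-lookup F γ (Dctx Θ) (trans (cong isUnit (typeOf-∋ (Match-Distinct m) (D-∋ p))) (trans (isUnit-Dty B) ns))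
      (Match-∈ m p)

⋆Args• : M.Ctx → C.Ctx → M.Sub → Set
⋆Args• F Θ γ = ∀ {w} → Θ C.∋ w ∶ C.⋆ → Σtm F (M.lookup γ w) ≡ C.var (fresh F)

⊢s⇒⋆Args• : ∀ {F Γ γ Θ} → Γ ⊢s γ ∶ Dctx Θ → Within F Γ → ⋆Args• F Θ γ
⊢s⇒⋆Args• {F} {Θ = Θ C.▸ y ∶ B} (▸-wf {γ = γ} {t = t} d _ _ dt) c C.here =
  trans (cong (Σtm F) (M-lookup-here γ y t)) (Σtm-unit dt refl c)
⊢s⇒⋆Args• {F} {Θ = Θ C.▸ y ∶ B} (▸-wf {γ = γ} {t = t} d _ y∉ dt) c (C.there p) =
  trans (cong (Σtm F) (M-lookup-there γ t (∈∧∉⇒≢ (C-∋⇒∈ p) (D-∉⁻ {Θ} y∉)))) (⊢s⇒⋆Args• d c p)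

≈s⇒⋆Args• : ∀ {F Γ γ γ' Θ} → Γ ⊢ γ ≈s γ' ∶ Dctx Θ → Within F Γ → ⋆Args• F Θ γ × ⋆Args• F Θ γ'
≈s⇒⋆Args• {F} {Θ = C.∅} (⟨⟩-eq w) c = (λ ()) , (λ ())
≈s⇒⋆Args• {F} {Θ = Θ C.▸ y ∶ B} (▸-eq {γ = γ} {γ'} {t = t} {u} d _ y∉ dt) c = left , right
  where
  left : ⋆Args• F (Θ C.▸ y ∶ B) (γ M.▸ y ↦ t)
  left C.here = trans (cong (Σtm F) (M-lookup-here γ y t)) (proj₁ (Σtm-unit-≈ dt refl c))
  left (C.there p) =
    trans (cong (Σtm F) (M-lookup-there γ t (∈∧∉⇒≢ (C-∋⇒∈ p) (D-∉⁻ {Θ} y∉)))) (proj₁ (≈s⇒⋆Args• d c) p)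
  right : ⋆Args• F (Θ C.▸ y ∶ B) (γ' M.▸ y ↦ u)
  right C.here = trans (cong (Σtm F) (M-lookup-here γ' y u)) (proj₂ (Σtm-unit-≈ dt refl c))
  right (C.there p) =
    trans (cong (Σtm F) (M-lookup-there γ' u (∈∧∉⇒≢ (C-∋⇒∈ p) (D-∉⁻ {Θ} y∉)))) (proj₂ (≈s⇒⋆Args• d c) p)

module _ (F : M.Ctx) {Θ : C.Ctx} {γ : M.Sub} (m : Match Θ γ) (γ⋆ : ⋆Args• F Θ γ) where
  Σ-[]-ty : ∀ {A} → RegTy Θ A → DΣty F (Dty A M.[ γ ]ty) ≡ Dty A M.[ Σargs F Θ γ ]ty
  Σ-[]-tm : ∀ {t} → RegTm Θ t → DΣtm F (Dtm t M.[ γ ]tm) ≡ Dtm t M.[ Σargs F Θ γ ]tm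
  Σ-∘ : ∀ {Θ' δ} → RegSub Θ Θ' δ → Σargs F Θ' (Dsub δ M.∘ γ) ≡ Dsub δ M.∘ Σargs F Θ γ
  Σ-[]-ty r⋆ = refl
  Σ-[]-ty (rHom a b c) = M-Hom-≡ (Σ-[]-ty a) (Σ-[]-tm b) (Σ-[]-tm c)
  Σ-[]-tm (rvar {B = C.⋆} p) = trans (cong Dtm (γ⋆ p)) (sym (Σargs-lookup F m p))
  Σ-[]-tm (rvar {B = C.Hom _ _ _} p) = sym (Σargs-lookup F m p)
  Σ-[]-tm (rcoh {Θ'} {A} g) = cong (M.mcoh Θ' A) (trans (D-bullet∘Σsub≡Σargs F (reg-Match γ g)) (Σ-∘ g))
  Σ-[]-tm (rop {Θ'} {A} g) = cong (M.mop Θ' A) (trans (D-bullet∘Σsub≡Σargs F (reg-Match γ g)) (Σ-∘ g))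
  Σ-∘ r⟨⟩ = refl
  Σ-∘ (r▸⋆ g y∉ p) = M-▸-≡ (Σ-∘ g) (sym (Σargs-lookup F m p))
  Σ-∘ (r▸Hom g y∉ k) = M-▸-≡ (Σ-∘ g) (Σ-[]-tm k)

DΣty-[] : ∀ {F Γ γ Θ A} → Γ ⊢s γ ∶ Dctx Θ → Within F Γ → RegTy Θ A →
          DΣty F (Dty A M.[ γ ]ty) ≡ Dty A M.[ Σargs F Θ γ ]ty
DΣty-[] {F} d c = Σ-[]-ty F (⊢s⇒Match d) (⊢s⇒⋆Args• d c)

DΣty-[]-≈s : ∀ {F Γ γ γ' Θ A} → Γ ⊢ γ ≈s γ' ∶ Dctx Θ → Within F Γ → RegTy Θ A →
             DΣty F (Dty A M.[ γ ]ty) ≡ Dty A M.[ Σargs F Θ γ ]ty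
DΣty-[]-≈s {F} d c = Σ-[]-ty F (proj₁ (≈s⇒Match d)) (proj₁ (≈s⇒⋆Args• d c))

DΣctx-• : ∀ F Γ → DΣctx F Γ M.∋ fresh F ∶ M.𝟙
DΣctx-• F M.∅ = M.here
DΣctx-• F (Γ M.▸ x ∶ M.𝟙) = DΣctx-• F Γ
DΣctx-• F (Γ M.▸ x ∶ M.Hom _ _ _) = M.there (DΣctx-• F Γ)

DΣctx-∋ : ∀ F {Γ x A} → Γ M.∋ x ∶ A → isUnit A ≡ false → DΣctx F Γ M.∋ x ∶ DΣty F A
DΣctx-∋ F {Γ M.▸ x ∶ M.Hom _ _ _} M.here e = M.here
DΣctx-∋ F {Γ M.▸ y ∶ M.𝟙} (M.there p) e = DΣctx-∋ F p e
DΣctx-∋ F {Γ M.▸ y ∶ M.Hom _ _ _} (M.there p) e = M.there (DΣctx-∋ F p e)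

DΣEntry : M.Ctx → M.Ctx → ℕ → M.Ty → Set
DΣEntry F Γ z B = (z ≡ fresh F × B ≡ M.𝟙) ⊎ Σ M.Ty (λ A → (Γ M.∋ z ∶ A) × (isUnit A ≡ false) × (B ≡ DΣty F A))

DΣEntry-there : ∀ {F Γ y A z B} → DΣEntry F Γ z B → DΣEntry F (Γ M.▸ y ∶ A) z B
DΣEntry-there (inj₁ e) = inj₁ e
DΣEntry-there (inj₂ (A , p , u , e)) = inj₂ (A , M.there p , u , e)

DΣctx-∋⁻ : ∀ F {Γ z B} → DΣctx F Γ M.∋ z ∶ B → DΣEntry F Γ z B
DΣctx-∋⁻ F {M.∅} M.here = inj₁ (refl , refl)
DΣctx-∋⁻ F {Γ M.▸ y ∶ M.𝟙} p = DΣEntry-there (DΣctx-∋⁻ F {Γ} p)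
DΣctx-∋⁻ F {Γ M.▸ y ∶ M.Hom A t u} M.here = inj₂ (M.Hom A t u , M.here , refl , refl)
DΣctx-∋⁻ F {Γ M.▸ y ∶ M.Hom A t u} (M.there p) = DΣEntry-there (DΣctx-∋⁻ F {Γ} p)

DΣctx-∉ : ∀ F {Γ x} → x ∉ M.names Γ → x ≢ fresh F → x ∉ M.names (DΣctx F Γ)
DΣctx-∉ F {Γ} x∉ x≢• p with M-∈⇒∋ p
... | B , q with DΣctx-∋⁻ F {Γ} q
... | inj₁ (e , _) = x≢• e
... | inj₂ (A , r , _ , _) = x∉ (M-∋⇒∈ r)

DΣctx-⊑ : ∀ F {Γ K} → Γ ⊑ K → DΣctx F Γ ⊑ DΣctx F K
DΣctx-⊑ F {Γ} {K} s p with DΣctx-∋⁻ F {Γ} p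
... | inj₁ (refl , refl) = DΣctx-• F K
... | inj₂ (A , q , u , refl) = DΣctx-∋ F (s q) u

DΣ-⊢ : ∀ {F Γ} → ⊢ Γ → Within F Γ → ⊢ DΣctx F Γ
DΣ-⊢ty : ∀ {F Γ A} → Γ ⊢ty A → Within F Γ → DΣctx F Γ ⊢ty DΣty F A
DΣ-⊢tm : ∀ {F Γ t A} → Γ ⊢ t ∶ A → Within F Γ → DΣctx F Γ ⊢ DΣtm F t ∶ DΣty F A
DΣ-⊢var : ∀ {F Γ x A} → ⊢ Γ → Γ M.∋ x ∶ A → Within F Γ → DΣctx F Γ ⊢ DΣtm F (M.var x) ∶ DΣty F A
DΣ-⊢s : ∀ {F Γ γ Θ} → Γ ⊢s γ ∶ Dctx Θ → VarCtx Θ → Within F Γ → DΣctx F Γ ⊢s Σargs F Θ γ ∶ Dctx Θ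
DΣ-≈ty : ∀ {F Γ A B} → Γ ⊢ A ≈ty B → Within F Γ → DΣctx F Γ ⊢ DΣty F A ≈ty DΣty F B
DΣ-≈ : ∀ {F Γ t u A} → Γ ⊢ t ≈ u ∶ A → Within F Γ → DΣctx F Γ ⊢ DΣtm F t ≈ DΣtm F u ∶ DΣty F A
DΣ-≈s : ∀ {F Γ γ γ' Θ} → Γ ⊢ γ ≈s γ' ∶ Dctx Θ → VarCtx Θ → Within F Γ →
        DΣctx F Γ ⊢ Σargs F Θ γ ≈s Σargs F Θ γ' ∶ Dctx Θ
DΣ-⊢ ⊢∅ c = ⊢ext (𝟙-wf ⊢∅) (λ ())
DΣ-⊢ (⊢ext {A = M.𝟙} d x∉) c = wf-ty (DΣ-⊢ty d (Within-tail c))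
DΣ-⊢ {F} (⊢ext {A = M.Hom _ _ _} d x∉) c = ⊢ext (DΣ-⊢ty d (Within-tail c)) (DΣctx-∉ F x∉ (Within-▸-≢• c))
DΣ-⊢ty (𝟙-wf w) c = 𝟙-wf (DΣ-⊢ w c)
DΣ-⊢ty (Hom-wf d e) c = Hom-wf (DΣ-⊢tm d c) (DΣ-⊢tm e c)
DΣ-⊢tm (var w p) c = DΣ-⊢var w p c
DΣ-⊢tm {F} (tt {Γ} w) c = var (DΣ-⊢ w c) (DΣctx-• F Γ)
DΣ-⊢tm {F} (mcoh {Θ} {A} pz wA fv d) c =
  reterm (cong (M.mcoh Θ A) (sym (D-bullet∘Σsub≡Σargs F (⊢s⇒Match d))))
    (retype (sym (DΣty-[] d c (mcoh-reg pz wA))) (mcoh pz wA fv (DΣ-⊢s d (⊢ps⇒VarCtx pz) c)))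
DΣ-⊢tm {F} (mop {Θ} {A} {t} {u} pz dt du f1 f2 d) c =
  reterm (cong (M.mop Θ (C.Hom A t u)) (sym (D-bullet∘Σsub≡Σargs F (⊢s⇒Match d))))
    (retype (sym (DΣty-[] d c (mop-reg pz dt du))) (mop pz dt du f1 f2 (DΣ-⊢s d (⊢ps⇒VarCtx pz) c)))
DΣ-⊢tm (conv d e) c = conv (DΣ-⊢tm d c) (DΣ-≈ty e c)
DΣ-⊢var {F} {Γ} {x} {M.𝟙} w p c =
  reterm (cong Dtm (sym (Σtm-var-unit F x (cong isUnit (typeOf-agrees c p))))) (var (DΣ-⊢ w c) (DΣctx-• F Γ))
DΣ-⊢var {F} {Γ} {x} {M.Hom _ _ _} w p c =
  reterm (cong Dtm (sym (Σtm-var-nonunit F x (cong isUnit (typeOf-agrees c p))))) (var (DΣ-⊢ w c) (DΣctx-∋ F p refl))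
DΣ-⊢s {Θ = C.∅} (⟨⟩-wf w) _ c = ⟨⟩-wf (DΣ-⊢ w c)
DΣ-⊢s {Θ = Θ C.▸ y ∶ C.⋆} (▸-wf d wA y∉ dt) (vΘ , _) c =
  ▸-wf (DΣ-⊢s d vΘ c) wA y∉ (reterm (cong Dtm (Σtm-unit dt refl c)) (DΣ-⊢tm dt c))
DΣ-⊢s {F} {Θ = Θ C.▸ y ∶ C.Hom B u v} (▸-wf d wA y∉ dt) (vΘ , vB) c =
  ▸-wf (DΣ-⊢s d vΘ c) wA y∉ (retype (DΣty-[] d c (VarTy⇒RegTy vB)) (DΣ-⊢tm dt c))
DΣ-≈ty (refl-ty d) c = refl-ty (DΣ-⊢ty d c)
DΣ-≈ty (sym-ty d) c = sym-ty (DΣ-≈ty d c)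
DΣ-≈ty (trans-ty d e) c = trans-ty (DΣ-≈ty d c) (DΣ-≈ty e c)
DΣ-≈ty (Hom-cong d e f) c = Hom-cong (DΣ-≈ty d c) (DΣ-≈ e c) (DΣ-≈ f c)
DΣ-≈ (refl-tm d) c = refl-tm (DΣ-⊢tm d c)
DΣ-≈ (sym-tm d) c = sym-tm (DΣ-≈ d c)
DΣ-≈ (trans-tm d e) c = trans-tm (DΣ-≈ d c) (DΣ-≈ e c)
DΣ-≈ (conv-eq d e) c = conv-eq (DΣ-≈ d c) (DΣ-≈ty e c)
DΣ-≈ {F} (η-𝟙 {Γ} d) c =
  reterm≈ (cong Dtm (sym (Σtm-unit d refl c))) refl (refl-tm (var (wf-tm (DΣ-⊢tm d c)) (DΣctx-• F Γ)))
DΣ-≈ {F} (mcoh-cong {Θ} {A} pz wA fv d) c =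
  reterm≈ (cong (M.mcoh Θ A) (sym (D-bullet∘Σsub≡Σargs F (proj₁ (≈s⇒Match d)))))
          (cong (M.mcoh Θ A) (sym (D-bullet∘Σsub≡Σargs F (proj₂ (≈s⇒Match d)))))
    (retype≈ (sym (DΣty-[]-≈s d c (mcoh-reg pz wA)))
      (mcoh-cong pz wA fv (DΣ-≈s d (⊢ps⇒VarCtx pz) c)))
DΣ-≈ {F} (mop-cong {Θ} {A} {t} {u} pz dt du f1 f2 d) c =
  reterm≈ (cong (M.mop Θ (C.Hom A t u)) (sym (D-bullet∘Σsub≡Σargs F (proj₁ (≈s⇒Match d)))))
          (cong (M.mop Θ (C.Hom A t u)) (sym (D-bullet∘Σsub≡Σargs F (proj₂ (≈s⇒Match d)))))
    (retype≈ (sym (DΣty-[]-≈s d c (mop-reg pz dt du)))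
      (mop-cong pz dt du f1 f2 (DΣ-≈s d (⊢ps⇒VarCtx pz) c)))
DΣ-≈s {Θ = C.∅} (⟨⟩-eq w) _ c = ⟨⟩-eq (DΣ-⊢ w c)
DΣ-≈s {Θ = Θ C.▸ y ∶ C.⋆} (▸-eq d wA y∉ dt) (vΘ , _) c =
  ▸-eq (DΣ-≈s d vΘ c) wA y∉
    (reterm≈ (cong Dtm (proj₁ (Σtm-unit-≈ dt refl c))) (cong Dtm (proj₂ (Σtm-unit-≈ dt refl c))) (DΣ-≈ dt c))
DΣ-≈s {F} {Θ = Θ C.▸ y ∶ C.Hom B u v} (▸-eq d wA y∉ dt) (vΘ , vB) c =
  ▸-eq (DΣ-≈s d vΘ c) wA y∉
    (retype≈ (DΣty-[]-≈s d c (VarTy⇒RegTy vB)) (DΣ-≈ dt c))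

ηsub : M.Ctx → M.Ctx → M.Sub
ηsub F M.∅ = M.⟨⟩ M.▸ fresh F ↦ M.tt
ηsub F (Γ M.▸ x ∶ M.𝟙) = ηsub F Γ
ηsub F (Γ M.▸ x ∶ M.Hom _ _ _) = ηsub F Γ M.▸ x ↦ M.var x

names≡dom-ηsub : ∀ F Γ → M.names (DΣctx F Γ) ≡ M-dom (ηsub F Γ)
names≡dom-ηsub F M.∅ = refl
names≡dom-ηsub F (Γ M.▸ x ∶ M.𝟙) = names≡dom-ηsub F Γ
names≡dom-ηsub F (Γ M.▸ x ∶ M.Hom _ _ _) = cong (x ∷_) (names≡dom-ηsub F Γ)

ηsub-scoped : ∀ F Γ → ScopedSub (M.names Γ) (ηsub F Γ)
ηsub-scoped F M.∅ = tt , tt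
ηsub-scoped F (Γ M.▸ x ∶ M.𝟙) = scoped-mono-sub (ηsub F Γ) there (ηsub-scoped F Γ)
ηsub-scoped F (Γ M.▸ x ∶ M.Hom _ _ _) = scoped-mono-sub (ηsub F Γ) there (ηsub-scoped F Γ) , here refl

ηsub-lookup-• : ∀ {F} Γ → Within F Γ → M.lookup (ηsub F Γ) (fresh F) ≡ M.tt
ηsub-lookup-• {F} M.∅ c = M-lookup-here M.⟨⟩ (fresh F) M.tt
ηsub-lookup-• (Γ M.▸ x ∶ M.𝟙) c = ηsub-lookup-• Γ (Within-tail c)
ηsub-lookup-• {F} (Γ M.▸ x ∶ M.Hom _ _ _) c =
  trans (M-lookup-there (ηsub F Γ) (M.var x) (≢-sym (Within-▸-≢• c))) (ηsub-lookup-• Γ (Within-tail c))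

ηsub-lookup : ∀ F Γ {z B} → Distinct Γ → Γ M.∋ z ∶ B → isUnit B ≡ false → M.lookup (ηsub F Γ) z ≡ M.var z
ηsub-lookup F (Γ M.▸ x ∶ M.Hom _ _ _) _ M.here _ = M-lookup-here (ηsub F Γ) x (M.var x)
ηsub-lookup F (Γ M.▸ y ∶ M.𝟙) (dΓ , _) (M.there p) u = ηsub-lookup F Γ dΓ p u
ηsub-lookup F (Γ M.▸ y ∶ M.Hom _ _ _) (dΓ , y∉) (M.there p) u =
  trans (M-lookup-there (ηsub F Γ) (M.var y) (∈∧∉⇒≢ (M-∋⇒∈ p) y∉)) (ηsub-lookup F Γ dΓ p u)

ηsub-▸ : ∀ F Γ x A T → ScopedTy (M.names (DΣctx F Γ)) T → x ∉ M.names (DΣctx F Γ) →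
         T M.[ ηsub F (Γ M.▸ x ∶ A) ]ty ≡ T M.[ ηsub F Γ ]ty
ηsub-▸ F Γ x M.𝟙 T h x∉ = refl
ηsub-▸ F Γ x (M.Hom _ _ _) T h x∉ = []-▸-fresh-ty T (ηsub F Γ) (M.var x) h x∉

DΣty-scoped : ∀ F Γ {z A} → ⊢ Γ → Within F Γ → Γ M.∋ z ∶ A → ScopedTy (M.names (DΣctx F Γ)) (DΣty F A)
DΣty-scoped F Γ {A = M.𝟙} w c p = tt
DΣty-scoped F Γ {A = M.Hom _ _ _} w c p = scoped-∋ (DΣctx F Γ) (DΣ-⊢ w c) (DΣctx-∋ F p refl)

DΣty-[]-∘ : ∀ F {Γ Θ γ} A σ → Γ ⊢s γ ∶ Dctx Θ → Within F Γ → RegTy Θ A →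
            DΣty F (Dty A M.[ γ ]ty) M.[ σ ]ty ≡ Dty A M.[ Σargs F Θ γ M.∘ σ ]ty
DΣty-[]-∘ F A σ d c r =
  trans (cong (M._[ σ ]ty) (DΣty-[] d c r))
        ([]-∘-ty (Dty A) _ σ (reg⇒scoped-Dctx r)
          (⊆-reflexive (trans (names≡dom d) (sym (dom-Σargs F (⊢s⇒Match d))))))

≈DΣ[η]-var : ∀ F Γ {x A} → ⊢ Γ → Γ M.∋ x ∶ A → Within F Γ →
             Γ ⊢ M.var x ≈ DΣtm F (M.var x) M.[ ηsub F Γ ]tm ∶ A
≈DΣ[η]-var F Γ {x} {M.𝟙} w p c =
  reterm≈ refl
    (sym (trans (cong (λ s → Dtm s M.[ ηsub F Γ ]tm) (Σtm-var-unit F x (cong isUnit (typeOf-agrees c p))))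
                (ηsub-lookup-• Γ c)))
    (η-𝟙 (var w p))
≈DΣ[η]-var F Γ {x} {M.Hom _ _ _} w p c =
  reterm≈ refl
    (sym (trans (cong (λ s → Dtm s M.[ ηsub F Γ ]tm) (Σtm-var-nonunit F x (cong isUnit (typeOf-agrees c p))))
                (ηsub-lookup F Γ (⊢⇒Distinct Γ w) p refl)))
    (refl-tm (var w p))

ηsub-⊢s : ∀ F Γ → ⊢ Γ → Within F Γ → Γ ⊢s ηsub F Γ ∶ DΣctx F Γ
≈DΣ[η]-∋ : ∀ F Γ {x A} → ⊢ Γ → Γ M.∋ x ∶ A → Within F Γ → Γ ⊢ A ≈ty DΣty F A M.[ ηsub F Γ ]ty
≈DΣ[η]-ty : ∀ F Γ {A} → Γ ⊢ty A → Within F Γ → Γ ⊢ A ≈ty DΣty F A M.[ ηsub F Γ ]ty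
≈DΣ[η]-tm : ∀ F Γ {t A} → Γ ⊢ t ∶ A → Within F Γ →
            (Γ ⊢ t ≈ DΣtm F t M.[ ηsub F Γ ]tm ∶ A) × (Γ ⊢ A ≈ty DΣty F A M.[ ηsub F Γ ]ty)
≈DΣ[η]-sub : ∀ F Γ {γ Θ} → Γ ⊢s γ ∶ Dctx Θ → Within F Γ →
             Γ ⊢ γ ≈s Σargs F Θ γ M.∘ ηsub F Γ ∶ Dctx Θ
ηsub-⊢s F M.∅ w c = ▸-wf (⟨⟩-wf ⊢∅) (𝟙-wf ⊢∅) (λ ()) (tt ⊢∅)
ηsub-⊢s F (Γ M.▸ x ∶ M.𝟙) (⊢ext d x∉) c = weaken-sub (ηsub-⊢s F Γ (wf-ty d) (Within-tail c)) ⊑-there (⊢ext d x∉)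
ηsub-⊢s F (Γ M.▸ x ∶ M.Hom A t u) (⊢ext d x∉) c =
  ▸-wf (weaken-sub (ηsub-⊢s F Γ (wf-ty d) (Within-tail c)) ⊑-there (⊢ext d x∉))
       (DΣ-⊢ty d (Within-tail c)) (DΣctx-∉ F x∉ (Within-▸-≢• c))
       (conv (var (⊢ext d x∉) M.here) (weaken-≈ty (≈DΣ[η]-ty F Γ d (Within-tail c)) ⊑-there (⊢ext d x∉)))
≈DΣ[η]-∋ F (Γ M.▸ x ∶ A) (⊢ext d x∉) M.here c =
  weaken-≈ty (recast≈ty refl (sym (ηsub-▸ F Γ x A (DΣty F A) (scoped-ty (DΣ-⊢ty d (Within-tail c)))
                                                            (DΣctx-∉ F x∉ (Within-▸-≢• c))))
               (≈DΣ[η]-ty F Γ d (Within-tail c)))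
    ⊑-there (⊢ext d x∉)
≈DΣ[η]-∋ F (Γ M.▸ y ∶ B) (⊢ext d y∉) (M.there {A = A} p) c =
  weaken-≈ty (recast≈ty refl (sym (ηsub-▸ F Γ y B (DΣty F A) (DΣty-scoped F Γ (wf-ty d) (Within-tail c) p)
                                                            (DΣctx-∉ F y∉ (Within-▸-≢• c))))
               (≈DΣ[η]-∋ F Γ (wf-ty d) p (Within-tail c)))
    ⊑-there (⊢ext d y∉)
≈DΣ[η]-ty F Γ (𝟙-wf w) c = refl-ty (𝟙-wf w)
≈DΣ[η]-ty F Γ (Hom-wf d e) c =
  Hom-cong (proj₂ (≈DΣ[η]-tm F Γ d c)) (proj₁ (≈DΣ[η]-tm F Γ d c)) (proj₁ (≈DΣ[η]-tm F Γ e c))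
≈DΣ[η]-tm F Γ (var w p) c = ≈DΣ[η]-var F Γ w p c , ≈DΣ[η]-∋ F Γ w p c
≈DΣ[η]-tm F Γ (tt w) c = reterm≈ refl (sym (ηsub-lookup-• Γ c)) (refl-tm (tt w)) , refl-ty (𝟙-wf w)
≈DΣ[η]-tm F Γ (mcoh {Θ} {A} pz wA fv d) c =
  reterm≈ refl (cong (λ s → M.mcoh Θ A (s M.∘ ηsub F Γ)) (sym (D-bullet∘Σsub≡Σargs F (⊢s⇒Match d))))
    (mcoh-cong pz wA fv (≈DΣ[η]-sub F Γ d c)) ,
  recast≈ty refl (sym (DΣty-[]-∘ F A (ηsub F Γ) d c (mcoh-reg pz wA)))
    (mcoh-ty-cong pz wA d (≈DΣ[η]-sub F Γ d c))
≈DΣ[η]-tm F Γ (mop {Θ} {A} {t} {u} pz dt du f1 f2 d) c =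
  reterm≈ refl (cong (λ s → M.mop Θ (C.Hom A t u) (s M.∘ ηsub F Γ)) (sym (D-bullet∘Σsub≡Σargs F (⊢s⇒Match d))))
    (mop-cong pz dt du f1 f2 (≈DΣ[η]-sub F Γ d c)) ,
  recast≈ty refl (sym (DΣty-[]-∘ F (C.Hom A t u) (ηsub F Γ) d c (mop-reg pz dt du)))
    (mop-ty-cong pz dt du d (≈DΣ[η]-sub F Γ d c))
≈DΣ[η]-tm F Γ (conv d q) c =
  conv-eq (proj₁ (≈DΣ[η]-tm F Γ d c)) q ,
  trans-ty (sym-ty q) (trans-ty (proj₂ (≈DΣ[η]-tm F Γ d c)) ([]-≈ty (DΣ-≈ty q c) (ηsub-⊢s F Γ (wf-tm d) c)))
≈DΣ[η]-sub F Γ {Θ = C.∅} (⟨⟩-wf w) c = ⟨⟩-eq w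
≈DΣ[η]-sub F Γ {Θ = Θ C.▸ y ∶ C.⋆} (▸-wf d wA y∉ dt) c =
  ▸-eq (≈DΣ[η]-sub F Γ d c) wA y∉ (reterm≈ refl (sym (ηsub-lookup-• Γ c)) (η-𝟙 dt))
≈DΣ[η]-sub F Γ {Θ = Θ C.▸ y ∶ C.Hom _ _ _} (▸-wf d wA y∉ dt) c =
  ▸-eq (≈DΣ[η]-sub F Γ d c) wA y∉ (proj₁ (≈DΣ[η]-tm F Γ dt c))

θval : M.Ty → ℕ → M.Tm
θval M.𝟙 z = M.tt
θval (M.Hom _ _ _) z = M.var z

θsub : M.Ctx → M.Sub
θsub M.∅ = M.⟨⟩
θsub (Γ M.▸ x ∶ A) = θsub Γ M.▸ x ↦ θval A x

names≡dom-θsub : ∀ Γ → M.names Γ ≡ M-dom (θsub Γ)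
names≡dom-θsub M.∅ = refl
names≡dom-θsub (Γ M.▸ x ∶ A) = cong (x ∷_) (names≡dom-θsub Γ)

θsub-lookup : ∀ Γ {z B} → Distinct Γ → Γ M.∋ z ∶ B → M.lookup (θsub Γ) z ≡ θval B z
θsub-lookup (Γ M.▸ x ∶ A) _ M.here = M-lookup-here (θsub Γ) x (θval A x)
θsub-lookup (Γ M.▸ y ∶ A) (dΓ , y∉) (M.there p) =
  trans (M-lookup-there (θsub Γ) (θval A y) (∈∧∉⇒≢ (M-∋⇒∈ p) y∉)) (θsub-lookup Γ dΓ p)

DΣ≈[θ]-var : ∀ F Γ {x A} → ⊢ Γ → Γ M.∋ x ∶ A → Within F Γ →
             DΣctx F Γ ⊢ DΣtm F (M.var x) ≈ M.lookup (θsub Γ) x ∶ DΣty F A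
DΣ≈[θ]-var F Γ {x} {M.𝟙} w p c =
  reterm≈ (cong Dtm (sym (Σtm-var-unit F x (cong isUnit (typeOf-agrees c p))))) (sym (θsub-lookup Γ (⊢⇒Distinct Γ w) p))
    (η-𝟙 (var (DΣ-⊢ w c) (DΣctx-• F Γ)))
DΣ≈[θ]-var F Γ {x} {M.Hom _ _ _} w p c =
  reterm≈ (cong Dtm (sym (Σtm-var-nonunit F x (cong isUnit (typeOf-agrees c p))))) (sym (θsub-lookup Γ (⊢⇒Distinct Γ w) p))
    (refl-tm (var (DΣ-⊢ w c) (DΣctx-∋ F p refl)))

θsub-⊢s : ∀ F Γ → ⊢ Γ → Within F Γ → DΣctx F Γ ⊢s θsub Γ ∶ Γ
DΣ≈[θ]-∋ : ∀ F Γ {x A} → ⊢ Γ → Γ M.∋ x ∶ A → Within F Γ → DΣctx F Γ ⊢ DΣty F A ≈ty A M.[ θsub Γ ]ty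
DΣ≈[θ]-ty : ∀ F Γ {A} → Γ ⊢ty A → Within F Γ → DΣctx F Γ ⊢ DΣty F A ≈ty A M.[ θsub Γ ]ty
DΣ≈[θ]-tm : ∀ F Γ {t A} → Γ ⊢ t ∶ A → Within F Γ →
            (DΣctx F Γ ⊢ DΣtm F t ≈ t M.[ θsub Γ ]tm ∶ DΣty F A) × (DΣctx F Γ ⊢ DΣty F A ≈ty A M.[ θsub Γ ]ty)
DΣ≈[θ]-sub : ∀ F Γ {γ Θ} → Γ ⊢s γ ∶ Dctx Θ → VarCtx Θ → Within F Γ →
             DΣctx F Γ ⊢ Σargs F Θ γ ≈s γ M.∘ θsub Γ ∶ Dctx Θ
θsub-⊢s F M.∅ w c = ⟨⟩-wf (DΣ-⊢ w c)
θsub-⊢s F (Γ M.▸ x ∶ M.𝟙) (⊢ext d x∉) c =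
  ▸-wf (θsub-⊢s F Γ (wf-ty d) (Within-tail c)) d x∉ (tt (DΣ-⊢ (⊢ext d x∉) c))
θsub-⊢s F (Γ M.▸ x ∶ M.Hom A t u) (⊢ext d x∉) c =
  ▸-wf (weaken-sub (θsub-⊢s F Γ (wf-ty d) (Within-tail c)) ⊑-there wΣ) d x∉
    (conv (var wΣ M.here) (weaken-≈ty (DΣ≈[θ]-ty F Γ d (Within-tail c)) ⊑-there wΣ))
  where wΣ = DΣ-⊢ (⊢ext d x∉) c
DΣ≈[θ]-∋ F (Γ M.▸ x ∶ M.𝟙) (⊢ext d x∉) M.here c = refl-ty (𝟙-wf (DΣ-⊢ (⊢ext d x∉) c))
DΣ≈[θ]-∋ F (Γ M.▸ x ∶ M.Hom A t u) (⊢ext d x∉) M.here c =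
  weaken-≈ty (recast≈ty refl (sym ([]-▸-fresh-ty (M.Hom A t u) (θsub Γ) (M.var x) (scoped-ty d) x∉))
                (DΣ≈[θ]-ty F Γ d (Within-tail c)))
    ⊑-there (DΣ-⊢ (⊢ext d x∉) c)
DΣ≈[θ]-∋ F (Γ M.▸ y ∶ M.𝟙) (⊢ext d y∉) (M.there {A = A} p) c =
  recast≈ty refl (sym ([]-▸-fresh-ty A (θsub Γ) M.tt (scoped-∋ Γ (wf-ty d) p) y∉))
    (DΣ≈[θ]-∋ F Γ (wf-ty d) p (Within-tail c))
DΣ≈[θ]-∋ F (Γ M.▸ y ∶ M.Hom _ _ _) (⊢ext d y∉) (M.there {A = A} p) c =
  weaken-≈ty (recast≈ty refl (sym ([]-▸-fresh-ty A (θsub Γ) (M.var y) (scoped-∋ Γ (wf-ty d) p) y∉))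
                (DΣ≈[θ]-∋ F Γ (wf-ty d) p (Within-tail c)))
    ⊑-there (DΣ-⊢ (⊢ext d y∉) c)
DΣ≈[θ]-ty F Γ (𝟙-wf w) c = refl-ty (𝟙-wf (DΣ-⊢ w c))
DΣ≈[θ]-ty F Γ (Hom-wf d e) c =
  Hom-cong (proj₂ (DΣ≈[θ]-tm F Γ d c)) (proj₁ (DΣ≈[θ]-tm F Γ d c)) (proj₁ (DΣ≈[θ]-tm F Γ e c))
DΣ≈[θ]-tm F Γ (var w p) c = DΣ≈[θ]-var F Γ w p c , DΣ≈[θ]-∋ F Γ w p c
DΣ≈[θ]-tm F Γ (tt w) c = η-𝟙 (var (DΣ-⊢ w c) (DΣctx-• F Γ)) , refl-ty (𝟙-wf (DΣ-⊢ w c))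
DΣ≈[θ]-tm F Γ (mcoh {Θ} {A} {γ = γ} pz wA fv d) c =
  reterm≈ (cong (M.mcoh Θ A) (sym (D-bullet∘Σsub≡Σargs F (⊢s⇒Match d)))) refl
    (retype≈ (sym (DΣty-[] d c (mcoh-reg pz wA))) (mcoh-cong pz wA fv Σγ≈γθ)) ,
  recast≈ty (sym (DΣty-[] d c (mcoh-reg pz wA)))
            (sym ([]-∘-ty (Dty A) γ (θsub Γ) (mcoh-scoped pz wA) (⊆-reflexive (names≡dom d))))
    (mcoh-ty-cong pz wA (DΣ-⊢s d (⊢ps⇒VarCtx pz) c) Σγ≈γθ)
  where Σγ≈γθ = DΣ≈[θ]-sub F Γ d (⊢ps⇒VarCtx pz) c
DΣ≈[θ]-tm F Γ (mop {Θ} {A} {t} {u} {γ = γ} pz dt du f1 f2 d) c =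
  reterm≈ (cong (M.mop Θ (C.Hom A t u)) (sym (D-bullet∘Σsub≡Σargs F (⊢s⇒Match d)))) refl
    (retype≈ (sym (DΣty-[] d c (mop-reg pz dt du))) (mop-cong pz dt du f1 f2 Σγ≈γθ)) ,
  recast≈ty (sym (DΣty-[] d c (mop-reg pz dt du)))
            (sym ([]-∘-ty (Dty (C.Hom A t u)) γ (θsub Γ) (mop-scoped pz dt du) (⊆-reflexive (names≡dom d))))
    (mop-ty-cong pz dt du (DΣ-⊢s d (⊢ps⇒VarCtx pz) c) Σγ≈γθ)
  where Σγ≈γθ = DΣ≈[θ]-sub F Γ d (⊢ps⇒VarCtx pz) c
DΣ≈[θ]-tm F Γ (conv d q) c =
  conv-eq (proj₁ (DΣ≈[θ]-tm F Γ d c)) (DΣ-≈ty q c) ,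
  trans-ty (sym-ty (DΣ-≈ty q c)) (trans-ty (proj₂ (DΣ≈[θ]-tm F Γ d c)) ([]-≈ty q (θsub-⊢s F Γ (wf-tm d) c)))
DΣ≈[θ]-sub F Γ {Θ = C.∅} (⟨⟩-wf w) _ c = ⟨⟩-eq (DΣ-⊢ w c)
DΣ≈[θ]-sub F Γ {Θ = Θ C.▸ y ∶ C.⋆} (▸-wf d wA y∉ dt) (vΘ , _) c =
  ▸-eq (DΣ≈[θ]-sub F Γ d vΘ c) wA y∉
    (trans-tm (η-𝟙 (var (DΣ-⊢ (wf-tm dt) c) (DΣctx-• F Γ))) (sym-tm (η-𝟙 ([]-⊢tm dt (θsub-⊢s F Γ (wf-tm dt) c)))))
DΣ≈[θ]-sub F Γ {Θ = Θ C.▸ y ∶ C.Hom _ _ _} (▸-wf d wA y∉ dt) (vΘ , vB) c =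
  ▸-eq (DΣ≈[θ]-sub F Γ d vΘ c) wA y∉ (retype≈ (DΣty-[] d c (VarTy⇒RegTy vB)) (proj₁ (DΣ≈[θ]-tm F Γ dt c)))

η-natural : ∀ {Δ K} Γ {γ} → ⊢ Δ → ⊢ K → Δ ⊢s γ ∶ Γ → Γ ⊑ K →
             Δ ⊢ ηsub K Γ M.∘ γ ≈s Dsub (Σsub Δ γ K) M.∘ ηsub Δ Δ ∶ DΣctx K Γ
η-natural {Δ} M.∅ wΔ wK (⟨⟩-wf _) s =
  ▸-eq (⟨⟩-eq wΔ) (𝟙-wf ⊢∅) (λ ()) (reterm≈ refl (sym (ηsub-lookup-• Δ (Within-self Δ wΔ))) (refl-tm (tt wΔ)))
η-natural {Δ} {K} (Γ M.▸ x ∶ M.𝟙) wΔ wK (▸-wf {γ = γ} {t = t} d _ x∉ _) s =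
  resub≈ (sym (∘-▸-fresh (ηsub K Γ) γ t (ηsub-scoped K Γ) x∉))
         (sym (cong (λ σ → Dsub σ M.∘ ηsub Δ Δ) (Σsub-▸-unit Δ γ K x t (cong isUnit (typeOf-agrees cK (s M.here))))))
    (η-natural Γ wΔ wK d (⊑-tail s))
  where cK = Within-self K wK
η-natural {Δ} {K} (Γ M.▸ x ∶ M.Hom A u v) wΔ wK (▸-wf {γ = γ} {t = t} d wA x∉ dt) s =
  resub≈ (sym (M-▸-≡ (∘-▸-fresh (ηsub K Γ) γ t (ηsub-scoped K Γ) x∉) (M-lookup-here γ x t)))
         (sym (cong (λ σ → Dsub σ M.∘ ηsub Δ Δ) (Σsub-▸-nonunit Δ γ K x t (cong isUnit (typeOf-agrees cK (s M.here))))))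
    (▸-eq (η-natural Γ wΔ wK d (⊑-tail s)) (DΣ-⊢ty wA cΓ) (DΣctx-∉ K x∉ (Within-▸-≢• (Within-⊑ s cK)))
      (conv-eq (proj₁ (≈DΣ[η]-tm Δ Δ dt (Within-self Δ wΔ)))
        (recast≈ty refl ([]-∘-ty (DΣty K (M.Hom A u v)) (ηsub K Γ) γ (scoped-ty (DΣ-⊢ty wA cΓ))
                                 (⊆-reflexive (names≡dom-ηsub K Γ)))
          ([]-≈ty (≈DΣ[η]-ty K Γ wA cΓ) d))))
  where
  cK = Within-self K wK
  cΓ = Within-⊑ (⊑-tail s) cK

θval-[ηsub] : ∀ F Γ {z B} → Distinct Γ → Γ M.∋ z ∶ B → θval B z M.[ ηsub F Γ ]tm ≡ θval B z
θval-[ηsub] F Γ {B = M.𝟙} dΓ p = refl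
θval-[ηsub] F Γ {B = M.Hom _ _ _} dΓ p = ηsub-lookup F Γ dΓ p refl

θ∘η-lookup : ∀ F {Γ Γ' z} → Distinct Γ → Distinct Γ' → Γ ⊑ Γ' → z ∈ M.names Γ →
             M.lookup (θsub Γ M.∘ ηsub F Γ') z ≡ M.lookup (θsub Γ) z
θ∘η-lookup F {Γ} {Γ'} dΓ dΓ' s z∈ with M-∈⇒∋ z∈
... | B , p = begin
  M.lookup (θsub Γ M.∘ ηsub F Γ') _  ≡⟨ M-lookup-∘ (θsub Γ) (ηsub F Γ') (⊆-reflexive (names≡dom-θsub Γ) z∈) ⟩
  M.lookup (θsub Γ) _ M.[ ηsub F Γ' ]tm ≡⟨ cong (M._[ ηsub F Γ' ]tm) (θsub-lookup Γ dΓ p) ⟩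
  θval B _ M.[ ηsub F Γ' ]tm           ≡⟨ θval-[ηsub] F Γ' dΓ' (s p) ⟩
  θval B _                             ≡⟨ sym (θsub-lookup Γ dΓ p) ⟩
  M.lookup (θsub Γ) _                  ∎
  where open ≡-Reasoning

η∘θ-lookup : ∀ F {Γ Γ' z} → Within F Γ → Distinct Γ → Distinct Γ' → Γ ⊑ Γ' → z ∈ M.names (DΣctx F Γ) →
             M.lookup (ηsub F Γ M.∘ θsub Γ') z ≡ M.lookup (ηsub F Γ) z
η∘θ-lookup F {Γ} {Γ'} c dΓ dΓ' s z∈ with M-∈⇒∋ z∈
... | B , q with DΣctx-∋⁻ F {Γ} q
... | inj₁ (refl , refl) =
  trans (M-lookup-∘ (ηsub F Γ) (θsub Γ') (⊆-reflexive (names≡dom-ηsub F Γ) z∈))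
        (trans (cong (M._[ θsub Γ' ]tm) (ηsub-lookup-• Γ c)) (sym (ηsub-lookup-• Γ c)))
... | inj₂ (A , p , nonunit , refl) =
  trans (M-lookup-∘ (ηsub F Γ) (θsub Γ') (⊆-reflexive (names≡dom-ηsub F Γ) z∈))
        (trans (cong (M._[ θsub Γ' ]tm) (ηsub-lookup F Γ dΓ p nonunit))
               (trans (θsub-lookup Γ' dΓ' (s p)) (trans (θval-nonunit A nonunit) (sym (ηsub-lookup F Γ dΓ p nonunit)))))
  where
  θval-nonunit : ∀ A {z} → isUnit A ≡ false → θval A z ≡ M.var z
  θval-nonunit (M.Hom _ _ _) _ = refl

θ∘η≈id : ∀ {K} Γ → ⊢ K → ⊢ Γ → Γ ⊑ K → K ⊢ θsub Γ M.∘ ηsub K K ≈s M.id Γ ∶ Γ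
θ∘η≈id M.∅ wK w s = ⟨⟩-eq wK
θ∘η≈id (Γ M.▸ x ∶ M.𝟙) wK (⊢ext d x∉) s =
  ▸-eq (θ∘η≈id Γ wK (wf-ty d) (⊑-tail s)) d x∉ (sym-tm (η-𝟙 (var wK (s M.here))))
θ∘η≈id {K} (Γ M.▸ x ∶ M.Hom A u v) wK (⊢ext d x∉) s =
  ▸-eq (θ∘η≈id Γ wK (wf-ty d) (⊑-tail s)) d x∉
    (reterm≈ (sym (ηsub-lookup K K dK (s M.here) refl)) refl
      (refl-tm (conv (var wK (s M.here)) (weaken-≈ty A≈A[θη] (⊑-tail s) wK))))
  where
  dK = ⊢⇒Distinct K wK
  dΓ = ⊢⇒Distinct Γ (wf-ty d)
  cΓ = Within-⊑ (⊑-tail s) (Within-self K wK)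
  A≈A[θη] : Γ ⊢ M.Hom A u v ≈ty M.Hom A u v M.[ θsub Γ M.∘ ηsub K K ]ty
  A≈A[θη] =
    trans-ty (≈DΣ[η]-ty K Γ d cΓ)
      (recast≈ty refl
         (trans ([]-∘-ty (M.Hom A u v) (θsub Γ) (ηsub K Γ) (scoped-ty d) (⊆-reflexive (names≡dom-θsub Γ)))
                ([]-agree-ty (M.Hom A u v) _ _ (scoped-ty d)
                   (λ z∈ → trans (θ∘η-lookup K dΓ dΓ ⊑-refl z∈) (sym (θ∘η-lookup K dΓ dK (⊑-tail s) z∈)))))
         ([]-≈ty (DΣ≈[θ]-ty K Γ d cΓ) (ηsub-⊢s K Γ (wf-ty d) cΓ)))

η∘θ≈id : ∀ {K} Γ → ⊢ K → ⊢ Γ → Γ ⊑ K →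
         DΣctx K K ⊢ ηsub K Γ M.∘ θsub K ≈s M.id (DΣctx K Γ) ∶ DΣctx K Γ
η∘θ≈id {K} M.∅ wK w s = ▸-eq (⟨⟩-eq wΣK) (𝟙-wf ⊢∅) (λ ()) (sym-tm (η-𝟙 (var wΣK (DΣctx-• K K))))
  where wΣK = DΣ-⊢ wK (Within-self K wK)
η∘θ≈id (Γ M.▸ x ∶ M.𝟙) wK (⊢ext d x∉) s = η∘θ≈id Γ wK (wf-ty d) (⊑-tail s)
η∘θ≈id {K} (Γ M.▸ x ∶ M.Hom A u v) wK (⊢ext d x∉) s =
  ▸-eq (η∘θ≈id Γ wK (wf-ty d) (⊑-tail s)) (DΣ-⊢ty d cΓ) (DΣctx-∉ K x∉ (Within-▸-≢• (Within-⊑ s cK)))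
    (reterm≈ (sym (θsub-lookup K dK (s M.here))) refl
      (refl-tm (conv (var wΣK (DΣctx-∋ K (s M.here) refl)) (weaken-≈ty ΣA≈ΣA[ηθ] (DΣctx-⊑ K (⊑-tail s)) wΣK))))
  where
  cK = Within-self K wK
  wΣK = DΣ-⊢ wK cK
  dK = ⊢⇒Distinct K wK
  dΓ = ⊢⇒Distinct Γ (wf-ty d)
  cΓ = Within-⊑ (⊑-tail s) cK
  ΣA = DΣty K (M.Hom A u v)
  ΣA≈ΣA[ηθ] : DΣctx K Γ ⊢ ΣA ≈ty ΣA M.[ ηsub K Γ M.∘ θsub K ]ty
  ΣA≈ΣA[ηθ] =
    trans-ty (DΣ≈[θ]-ty K Γ d cΓ)
      (recast≈ty refl
         (trans ([]-∘-ty ΣA (ηsub K Γ) (θsub Γ) (scoped-ty (DΣ-⊢ty d cΓ)) (⊆-reflexive (names≡dom-ηsub K Γ)))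
                ([]-agree-ty ΣA _ _ (scoped-ty (DΣ-⊢ty d cΓ))
                   (λ z∈ → trans (η∘θ-lookup K cΓ dΓ dΓ ⊑-refl z∈) (sym (η∘θ-lookup K cΓ dΓ dK (⊑-tail s) z∈)))))
         ([]-≈ty (≈DΣ[η]-ty K Γ d cΓ) (θsub-⊢s K Γ (wf-ty d) cΓ)))

mainTheorem15 : Σ (M.Ctx → M.Sub) IsNatIso
mainTheorem15 =
  (λ Γ → ηsub Γ Γ) ,
  (λ Γ w → ηsub-⊢s Γ Γ w (Within-self Γ w)) ,
  (λ Δ Γ γ wΔ wΓ d → η-natural Γ wΔ wΓ d ⊑-refl) ,
  (λ Γ w → θsub Γ , θsub-⊢s Γ Γ w (Within-self Γ w) , θ∘η≈id Γ w w ⊑-refl , η∘θ≈id Γ w w ⊑-refl)
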